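{- Let $M$ be a connected graph and $u\in V(M)$ with $2\le d_M(u)\le4$. Let $H$ be the graph obtained from $M$ by attaching a path $P_a$ ($a\ge1$) to $u$, i.e., adding a new path on $a$ vertices and an edge joining $u$ to one end of it; let $u'$ be the other end of this path (the pendent vertex of the attached path; $u'$ is the single new vertex if $a=1$). Let $u_1,u_2$ be two distinct neighbors of $u$ in $M$, and let $H'=H-uu_2+u'u_2$ (delete edge $uu_2$, add edge $u'u_2$). (i) If $d_M(u)=2$ and the maximum degree of $M$ is at most five, then $\chi(H')>\chi(H)$. (ii) If $d_M(u)=3$, at least two neighbors of $u$ in $M$ have degree two, and $d_M(u_2)=2$, then $\chi(H')>\chi(H)$. (iii) If $d_M(u)=4$ and all neighbors of $u$ in $M$ have degree two, then $\chi(H')>\chi(H)$.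
   Context: All graphs are simple. For a graph $G$, $d_G(u)$ is the degree of $u$. The sum--connectivity index is $\chi(G)=\sum_{uv\in E(G)}\frac{1}{\sqrt{d_G(u)+d_G(v)}}$. $P_a$ denotes the path on $a$ vertices. -}

module Defs where

open import Data.Bool using (Bool; true; false; _∧_; _∨_; if_then_else_)
open import Data.Nat as ℕ using (ℕ; zero; suc)
open import Data.Fin using (Fin; toℕ; splitAt; _↑ˡ_; _↑ʳ_; fromℕ; _≟_)
open import Data.Fin.Base using () renaming (zero to fzero)
open import Data.List using (List; []; _∷_; foldr; map; concatMap)
open import Data.List.Base using (allFin)
open import Data.List.Relation.Binary.Pointwise using (Pointwise)
open import Data.Sum using (_⊎_; inj₁; inj₂)
open import Data.Product using (_×_; ∃₂; ∃)
open import Data.Integer using (+_)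
open import Data.Rational as ℚ using (ℚ; 0ℚ; 1ℚ)
open import Relation.Binary.PropositionalEquality using (_≡_; _≢_)
open import Relation.Nullary.Decidable using (⌊_⌋)

AdjFn : ℕ → Set
AdjFn n = Fin n → Fin n → Bool

IsSimple : ∀ {n} → AdjFn n → Set
IsSimple {n} G = ((i j : Fin n) → G i j ≡ G j i) × ((i : Fin n) → G i i ≡ false)

deg : ∀ {n} → AdjFn n → Fin n → ℕ
deg {n} G u = foldr (λ j acc → (if G u j then 1 else 0) ℕ.+ acc) 0 (allFin n)

data Reach {n} (G : AdjFn n) : Fin n → Fin n → Set where
  here : ∀ {i} → Reach G i i
  step : ∀ {i k j} → G i k ≡ true → Reach G k j → Reach G i j

Connected : ∀ {n} → AdjFn n → Set
Connected {n} G = (i j : Fin n) → Reach G i j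

edgeDegSums : ∀ {n} → AdjFn n → List ℕ
edgeDegSums {n} G =
  concatMap (λ i → concatMap (λ j →
    if (G i j ∧ (toℕ i ℕ.<ᵇ toℕ j)) then (deg G i ℕ.+ deg G j) ∷ [] else [])
    (allFin n)) (allFin n)

-- A real number  Σ_{s∈xs} 1/√s  is strictly less than  Σ_{s∈ys} 1/√s
-- iff there are rational upper bounds of the terms of the first sum and
-- rational lower bounds of the terms of the second sum with
-- (sum of upper bounds) < (sum of lower bounds).

ℕtoℚ : ℕ → ℚ
ℕtoℚ s = (+ s) ℚ./ 1

LowerInvSqrt : ℕ → ℚ → Set
LowerInvSqrt s q = q ℚ.≤ 0ℚ ⊎ (q ℚ.* q) ℚ.* ℕtoℚ s ℚ.≤ 1ℚ

UpperInvSqrt : ℕ → ℚ → Set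
UpperInvSqrt s q = 0ℚ ℚ.≤ q × 1ℚ ℚ.≤ (q ℚ.* q) ℚ.* ℕtoℚ s

sumℚ : List ℚ → ℚ
sumℚ = foldr ℚ._+_ 0ℚ

SumInvSqrt-< : List ℕ → List ℕ → Set
SumInvSqrt-< xs ys =
  ∃₂ λ (us ls : List ℚ) →
    Pointwise UpperInvSqrt xs us × Pointwise LowerInvSqrt ys ls × sumℚ us ℚ.< sumℚ ls

χ-< : ∀ {n m} → AdjFn n → AdjFn m → Set
χ-< G G' = SumInvSqrt-< (edgeDegSums G) (edgeDegSums G')

-- Vertices of H: Fin (n + a);
-- i ↑ˡ a are the vertices of M, n ↑ʳ k (k : Fin a) the path vertices
-- p_0, ..., p_b, with u ~ p_0 and p_k ~ p_{k+1}.  u' = p_b.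

attachPath : ∀ {n} (M : AdjFn n) (u : Fin n) (b : ℕ) → AdjFn (n ℕ.+ suc b)
attachPath {n} M u b x y with splitAt n x | splitAt n y
... | inj₁ i | inj₁ j = M i j
... | inj₁ i | inj₂ k = ⌊ i ≟ u ⌋ ∧ (toℕ k ℕ.≡ᵇ 0)
... | inj₂ k | inj₁ i = ⌊ i ≟ u ⌋ ∧ (toℕ k ℕ.≡ᵇ 0)
... | inj₂ k | inj₂ l = (suc (toℕ k) ℕ.≡ᵇ toℕ l) ∨ (suc (toℕ l) ℕ.≡ᵇ toℕ k)

pendent : (n b : ℕ) → Fin (n ℕ.+ suc b)
pendent n b = n ↑ʳ fromℕ b

samePair : ∀ {N} → Fin N → Fin N → Fin N → Fin N → Bool
samePair x y p q = (⌊ x ≟ p ⌋ ∧ ⌊ y ≟ q ⌋) ∨ (⌊ x ≟ q ⌋ ∧ ⌊ y ≟ p ⌋)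

moveEdge : ∀ {N} → AdjFn N → (p q r s : Fin N) → AdjFn N
moveEdge G p q r s x y =
  if samePair x y p q then false
  else if samePair x y r s then true
  else G x y

-- Only the edges near u change weight.  Passing from H to H' lowers d(u) from d_M(u) + 1 back
-- to d_M(u), so every other edge at u, in particular uu₁, gains weight; the edge uu₂ of weight
-- 1/√(d_M(u) + d_M(u₂) + 1) is replaced by u'u₂ of weight 1/√(d_M(u₂) + 2); the edge from u to
-- the path gets weight 1/√(d_M(u) + 2); and the last edge of the path drops from 1/√3 to 1/2.
-- In each case what remains is an inequality between a few values 1/√s with small s.  To stay
-- within the rationals, 1/√s is bounded from above by ⌈N/√s⌉/N on the edges of H and from below
-- by ⌊N/√s⌋/N on those of H', with N = 1000 K and K > |E(M)|: rounding costs at most one unit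
-- per edge of M, less than K units in all, while the exact difference is worth more than K
-- units, as a finite computation with ⌊1000/√s⌋ and ⌈1000/√s⌉ shows.

module Submission where

open import Defs
open import Data.Bool using (Bool; true; false; T; if_then_else_; _∧_; _∨_)
open import Data.Bool.Properties using (∧-zeroʳ; ∧-identityʳ; ∧-comm; ∨-comm; ∧-distribʳ-∨; T-≡)
open import Data.Empty using (⊥-elim)
open import Data.Fin using (Fin; toℕ; _↑ˡ_; _↑ʳ_; _≟_; splitAt; fromℕ; fromℕ<; inject₁) renaming (zero to fzero; suc to fsuc)
import Data.Fin.Properties as Finₚ
open import Data.Integer as ℤ using (ℤ)
import Data.Integer.Properties as ℤ
import Data.Integer.Tactic.RingSolver as ℤSolver
open import Data.List using (List; []; _∷_; _++_; foldr; map; concatMap; tabulate; allFin)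
open import Data.List.Properties using (map-++)
open import Data.List.Relation.Binary.Pointwise using (Pointwise; []; _∷_)
open import Data.List.Relation.Unary.All using (All; []; _∷_)
open import Data.List.Relation.Unary.All.Properties using (++⁺)
open import Data.Nat using (ℕ; zero; suc; _+_; _*_; _∸_; _≤_; _<_; z≤n; s≤s; s≤s⁻¹; _≤ᵇ_; _<ᵇ_; _≡ᵇ_; >-nonZero; NonZero)
import Data.Nat.ListAction as ListAction
open import Data.Nat.ListAction.Properties using (sum-++)
open import Data.Nat.Properties hiding (_≟_)
open import Data.Nat.Tactic.RingSolver using (solve-∀)
open import Data.Product using (_×_; _,_; proj₁; Σ)
open import Data.Rational as ℚ using (ℚ; toℚᵘ)
open import Data.Rational.Properties using (toℚᵘ-fromℚᵘ; toℚᵘ-homo-*; toℚᵘ-homo-+; toℚᵘ-cancel-≤; toℚᵘ-cancel-<; toℚᵘ-injective)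
open import Data.Rational.Unnormalised as ℚᵘ using (mkℚᵘ; *≤*; *<*; *≡*)
import Data.Rational.Unnormalised.Properties as ℚᵘ
open import Data.Sum using (_⊎_; inj₁; inj₂)
open import Function using (_∘_; id; _⟨_⟩_)
open import Function.Bundles using (Equivalence)
open import Relation.Binary.Definitions using (tri<; tri≈; tri>)
open import Relation.Binary.PropositionalEquality
open import Relation.Nullary using (¬_; yes; no)
open import Relation.Nullary.Decidable using (⌊_⌋; toWitness)

open import Algebra.Properties.Semiring.Sum +-*-semiring
  using (sum; sum-syntax; sum-cong-≗; ∑-distrib-+)

𝟙 : Bool → ℕ
𝟙 b = if b then 1 else 0

𝟙-∨ : ∀ x y → ¬ (x ≡ true × y ≡ true) → 𝟙 (x ∨ y) ≡ 𝟙 x + 𝟙 y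
𝟙-∨ true  true  ¬both = ⊥-elim (¬both (refl , refl))
𝟙-∨ true  false _     = refl
𝟙-∨ false y     _     = refl

𝟙≤1 : ∀ x → 𝟙 x ≤ 1
𝟙≤1 true  = ≤-refl
𝟙≤1 false = z≤n

∧-true : ∀ {x y} → x ∧ y ≡ true → x ≡ true × y ≡ true
∧-true {true} {true} _ = refl , refl

∨-true : ∀ {x y} → x ∨ y ≡ true → x ≡ true ⊎ y ≡ true
∨-true {true}          _ = inj₁ refl
∨-true {false} {true}  _ = inj₂ refl

T⇒≡true : ∀ {x} → T x → x ≡ true
T⇒≡true = Equivalence.to T-≡

≡true⇒T : ∀ {x} → x ≡ true → T x
≡true⇒T = Equivalence.from T-≡

<ᵇ-true : ∀ {m n} → m < n → (m <ᵇ n) ≡ true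
<ᵇ-true = T⇒≡true ∘ <⇒<ᵇ

<ᵇ-false : ∀ {m n} → ¬ m < n → (m <ᵇ n) ≡ false
<ᵇ-false {m} {n} m≮n with m <ᵇ n in m<ᵇn
... | false = refl
... | true  = ⊥-elim (m≮n (<ᵇ⇒< m n (≡true⇒T m<ᵇn)))

+-<ᵇ : ∀ m x y → (m + x <ᵇ m + y) ≡ (x <ᵇ y)
+-<ᵇ zero    x y = refl
+-<ᵇ (suc m) x y = +-<ᵇ m x y

m+[n∸m]≤1+n : ∀ {m n} → m ≤ suc n → m + (n ∸ m) ≤ suc n
m+[n∸m]≤1+n {m} {n} m≤1+n with m ≤? n
... | yes m≤n = ≤-trans (≤-reflexive (m+[n∸m]≡n m≤n)) (n≤1+n n)
... | no  m≰n = ≤-trans (≤-reflexive (trans (cong (m +_) (m≤n⇒m∸n≡0 (<⇒≤ (≰⇒> m≰n)))) (+-identityʳ m))) m≤1+n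

∑-mono-≤ : ∀ {n} {f g : Fin n → ℕ} → (∀ i → f i ≤ g i) → sum f ≤ sum g
∑-mono-≤ {zero}  _   = z≤n
∑-mono-≤ {suc n} f≤g = +-mono-≤ (f≤g fzero) (∑-mono-≤ (f≤g ∘ fsuc))

∑-zero : ∀ {n} (f : Fin n → ℕ) → (∀ i → f i ≡ 0) → sum f ≡ 0
∑-zero {zero}  f _  = refl
∑-zero {suc n} f f0 = cong₂ _+_ (f0 fzero) (∑-zero (f ∘ fsuc) (f0 ∘ fsuc))

∑-supportedAt : ∀ {n} (f : Fin n → ℕ) p → (∀ i → i ≢ p → f i ≡ 0) → sum f ≡ f p
∑-supportedAt f fzero f0 =
  trans (cong (f fzero +_) (∑-zero (f ∘ fsuc) (λ i → f0 (fsuc i) λ ()))) (+-identityʳ _)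
∑-supportedAt f (fsuc p) f0 =
  cong₂ _+_ (f0 fzero λ ()) (∑-supportedAt (f ∘ fsuc) p (λ i i≢p → f0 (fsuc i) (i≢p ∘ Finₚ.suc-injective)))

term≤∑ : ∀ {n} (f : Fin n → ℕ) i → f i ≤ sum f
term≤∑ f fzero    = m≤m+n _ _
term≤∑ f (fsuc i) = ≤-trans (term≤∑ (f ∘ fsuc) i) (m≤n+m _ _)

∑-≤-* : ∀ {n} {f : Fin n → ℕ} c → (∀ i → f i ≤ c) → sum f ≤ n * c
∑-≤-* {zero}  c _   = z≤n
∑-≤-* {suc n} c f≤c = +-mono-≤ (f≤c fzero) (∑-≤-* c (f≤c ∘ fsuc))

∑-↑ : ∀ m n (f : Fin (m + n) → ℕ) → sum f ≡ sum (λ i → f (i ↑ˡ n)) + sum (λ k → f (m ↑ʳ k))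
∑-↑ zero    n f = refl
∑-↑ (suc m) n f = trans (cong (f fzero +_) (∑-↑ m n (f ∘ fsuc))) (sym (+-assoc (f fzero) _ _))

∑∑ : ∀ {m n} → (Fin m → Fin n → ℕ) → ℕ
∑∑ {m} {n} f = ∑[ i < m ] ∑[ j < n ] f i j

∑∑-mono-≤ : ∀ {m n} (f g : Fin m → Fin n → ℕ) → (∀ i j → f i j ≤ g i j) → ∑∑ f ≤ ∑∑ g
∑∑-mono-≤ f g f≤g = ∑-mono-≤ λ i → ∑-mono-≤ (f≤g i)

∑∑-cong : ∀ {m n} (f g : Fin m → Fin n → ℕ) → (∀ i j → f i j ≡ g i j) → ∑∑ f ≡ ∑∑ g
∑∑-cong f g f≡g = sum-cong-≗ λ i → sum-cong-≗ (f≡g i)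

∑∑-distrib-+ : ∀ {m n} (f g : Fin m → Fin n → ℕ) → ∑∑ (λ i j → f i j + g i j) ≡ ∑∑ f + ∑∑ g
∑∑-distrib-+ {m} {n} f g = trans (sum-cong-≗ λ i → ∑-distrib-+ (f i) (g i))
                                 (∑-distrib-+ {m} (λ i → ∑[ j < n ] f i j) (λ i → ∑[ j < n ] g i j))

∑∑-zero : ∀ {m n} (f : Fin m → Fin n → ℕ) → (∀ i j → f i j ≡ 0) → ∑∑ f ≡ 0
∑∑-zero f f0 = ∑-zero _ λ i → ∑-zero (f i) (f0 i)

∑∑-supportedAt : ∀ {m n} (f : Fin m → Fin n → ℕ) p q →
                 (∀ i j → i ≢ p → f i j ≡ 0) → (∀ j → j ≢ q → f p j ≡ 0) → ∑∑ f ≡ f p q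
∑∑-supportedAt {n = n} f p q f0 fp0 =
  trans (∑-supportedAt (λ i → ∑[ j < n ] f i j) p λ i i≢p → ∑-zero (f i) λ j → f0 i j i≢p)
        (∑-supportedAt (f p) q fp0)

∑∑-↑ : ∀ m a (f : Fin (m + a) → Fin (m + a) → ℕ) →
       ∑∑ f ≡ (∑∑ (λ i j → f (i ↑ˡ a) (j ↑ˡ a)) + ∑∑ (λ i k → f (i ↑ˡ a) (m ↑ʳ k)))
            + (∑∑ (λ k i → f (m ↑ʳ k) (i ↑ˡ a)) + ∑∑ (λ k l → f (m ↑ʳ k) (m ↑ʳ l)))
∑∑-↑ m a f = trans (∑-↑ m a (λ x → ∑[ y < m + a ] f x y)) (cong₂ _+_
  (trans (sum-cong-≗ λ i → ∑-↑ m a (f (i ↑ˡ a))) (∑-distrib-+ {m} (λ i → ∑[ j < m ] f (i ↑ˡ a) (j ↑ˡ a)) _))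
  (trans (sum-cong-≗ λ k → ∑-↑ m a (f (m ↑ʳ k))) (∑-distrib-+ {a} (λ k → ∑[ i < m ] f (m ↑ʳ k) (i ↑ˡ a)) _)))

foldr-tabulate : ∀ {A : Set} {n} (f : Fin n → A) (h : A → ℕ) →
                 foldr (λ x acc → h x + acc) 0 (tabulate f) ≡ sum (h ∘ f)
foldr-tabulate {n = zero}  f h = refl
foldr-tabulate {n = suc n} f h = cong (h (f fzero) +_) (foldr-tabulate (f ∘ fsuc) h)

sum-map-concatMap-tabulate : ∀ {A B : Set} {n} (f : Fin n → A) (g : A → List B) (w : B → ℕ) →
  ListAction.sum (map w (concatMap g (tabulate f))) ≡ ∑[ i < n ] ListAction.sum (map w (g (f i)))
sum-map-concatMap-tabulate {n = zero}  f g w = refl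
sum-map-concatMap-tabulate {n = suc n} f g w = begin
  ListAction.sum (map w (g (f fzero) ++ concatMap g (tabulate (f ∘ fsuc))))
    ≡⟨ cong ListAction.sum (map-++ w (g (f fzero)) _) ⟩
  ListAction.sum (map w (g (f fzero)) ++ map w (concatMap g (tabulate (f ∘ fsuc))))
    ≡⟨ sum-++ (map w (g (f fzero))) _ ⟩
  ListAction.sum (map w (g (f fzero))) + ListAction.sum (map w (concatMap g (tabulate (f ∘ fsuc))))
    ≡⟨ cong (ListAction.sum (map w (g (f fzero))) +_) (sum-map-concatMap-tabulate (f ∘ fsuc) g w) ⟩
  ListAction.sum (map w (g (f fzero))) + (∑[ i < n ] ListAction.sum (map w (g (f (fsuc i))))) ∎
  where open ≡-Reasoning

All-concatMap-tabulate : ∀ {A B : Set} {P : B → Set} {n} (f : Fin n → A) (g : A → List B) →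
                         (∀ i → All P (g (f i))) → All P (concatMap g (tabulate f))
All-concatMap-tabulate {n = zero}  f g _  = []
All-concatMap-tabulate {n = suc n} f g Pg = ++⁺ (Pg fzero) (All-concatMap-tabulate (f ∘ fsuc) g (Pg ∘ fsuc))

deg≡∑ : ∀ {N} (G : AdjFn N) x → deg G x ≡ ∑[ y < N ] 𝟙 (G x y)
deg≡∑ G x = foldr-tabulate id (λ y → 𝟙 (G x y))

deg-pos : ∀ {N} (G : AdjFn N) {x y} → G x y ≡ true → 1 ≤ deg G x
deg-pos {N} G {x} {y} Gxy rewrite deg≡∑ G x = ≤-trans (≤-reflexive (cong 𝟙 (sym Gxy))) (term≤∑ (λ z → 𝟙 (G x z)) y)

_<ᶠ_ : ∀ {n} → Fin n → Fin n → Bool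
i <ᶠ j = toℕ i <ᵇ toℕ j

edgeTerm : ∀ {N} → AdjFn N → (ℕ → ℕ) → Fin N → Fin N → ℕ
edgeTerm G w i j = if G i j ∧ i <ᶠ j then w (deg G i + deg G j) else 0

∑ᴱ : ∀ {N} → AdjFn N → (ℕ → ℕ) → ℕ
∑ᴱ G w = ListAction.sum (map w (edgeDegSums G))

∑ᴱ≡∑∑ : ∀ {N} (G : AdjFn N) w → ∑ᴱ G w ≡ ∑[ i < N ] ∑[ j < N ] edgeTerm G w i j
∑ᴱ≡∑∑ {N} G w = trans (sum-map-concatMap-tabulate id row w) (sum-cong-≗ λ i →
  trans (sum-map-concatMap-tabulate id (entry i) w) (sum-cong-≗ λ j → singleton (G i j ∧ (toℕ i <ᵇ toℕ j))))
  where
  entry : Fin N → Fin N → List ℕ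
  entry i j = if G i j ∧ (toℕ i <ᵇ toℕ j) then (deg G i + deg G j) ∷ [] else []
  row : Fin N → List ℕ
  row i = concatMap (entry i) (allFin N)
  singleton : ∀ c {s} → ListAction.sum (map w (if c then s ∷ [] else [])) ≡ (if c then w s else 0)
  singleton true  = +-identityʳ _
  singleton false = refl

edgeDegSums-pos : ∀ {N} (G : AdjFn N) → All (1 ≤_) (edgeDegSums G)
edgeDegSums-pos G = All-concatMap-tabulate id _ λ i → All-concatMap-tabulate id _ λ j → edge i j _ refl
  where
  edge : ∀ i j c → G i j ∧ (toℕ i <ᵇ toℕ j) ≡ c → All (1 ≤_) (if c then (deg G i + deg G j) ∷ [] else [])
  edge i j false _   = []
  edge i j true  Gij = ≤-trans (deg-pos G (proj₁ (∧-true Gij))) (m≤m+n _ _) ∷ []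

‖_‖ : ∀ {n} → AdjFn n → ℕ
‖ G ‖ = ∑∑ λ i j → 𝟙 (G i j ∧ i <ᶠ j)

‖‖≤n² : ∀ {n} (G : AdjFn n) → ‖ G ‖ ≤ n * n
‖‖≤n² {n} G = ∑-≤-* (n * 1) (λ i → ∑-≤-* 1 λ j → 𝟙≤1 (G i j ∧ i <ᶠ j)) ⟨ ≤-trans ⟩ ≤-reflexive (cong (n *_) (*-identityʳ n))

≟-≡ : ∀ {N} {x y : Fin N} → x ≡ y → ⌊ x ≟ y ⌋ ≡ true
≟-≡ {x = x} {y} x≡y with x ≟ y
... | yes _   = refl
... | no  x≢y = ⊥-elim (x≢y x≡y)

≟-≢ : ∀ {N} {x y : Fin N} → x ≢ y → ⌊ x ≟ y ⌋ ≡ false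
≟-≢ {x = x} {y} x≢y with x ≟ y
... | yes x≡y = ⊥-elim (x≢y x≡y)
... | no  _   = refl

≟-true : ∀ {N} {x y : Fin N} → ⌊ x ≟ y ⌋ ≡ true → x ≡ y
≟-true {x = x} {y} eq with x ≟ y
... | yes x≡y = x≡y

≟-false : ∀ {N} {x y : Fin N} → ⌊ x ≟ y ⌋ ≡ false → x ≢ y
≟-false x≟y x≡y with () ← trans (sym (≟-≡ x≡y)) x≟y

≟-injective : ∀ {M N} (f : Fin M → Fin N) → (∀ {x y} → f x ≡ f y → x ≡ y) →
              ∀ x y → ⌊ f x ≟ f y ⌋ ≡ ⌊ x ≟ y ⌋
≟-injective f f-inj x y with x ≟ y
... | yes refl = ≟-≡ {x = f x} refl
... | no  x≢y  = ≟-≢ (x≢y ∘ f-inj)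

samePair-true : ∀ {N} {x y p q : Fin N} → samePair x y p q ≡ true → (x ≡ p × y ≡ q) ⊎ (x ≡ q × y ≡ p)
samePair-true {x = x} {y} {p} {q} eq with ∨-true {⌊ x ≟ p ⌋ ∧ ⌊ y ≟ q ⌋} eq
... | inj₁ xy≡pq = let (x≡p , y≡q) = ∧-true xy≡pq in inj₁ (≟-true x≡p , ≟-true y≡q)
... | inj₂ xy≡qp = let (x≡q , y≡p) = ∧-true {⌊ x ≟ q ⌋} xy≡qp in inj₂ (≟-true x≡q , ≟-true y≡p)

samePair-injective : ∀ {M N} (f : Fin M → Fin N) → (∀ {x y} → f x ≡ f y → x ≡ y) →
                     ∀ x y p q → samePair (f x) (f y) (f p) (f q) ≡ samePair x y p q
samePair-injective f f-inj x y p q =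
  cong₂ _∨_ (cong₂ _∧_ (f-≟ x p) (f-≟ y q)) (cong₂ _∧_ (f-≟ x q) (f-≟ y p))
  where f-≟ = ≟-injective f f-inj

samePair-false : ∀ {N} {x y p q : Fin N} → (x ≢ p ⊎ y ≢ q) → (x ≢ q ⊎ y ≢ p) → samePair x y p q ≡ false
samePair-false xy≢pq xy≢qp = cong₂ _∨_ (∧-false xy≢pq) (∧-false xy≢qp)
  where
  ∧-false : ∀ {N} {x y p q : Fin N} → (x ≢ p ⊎ y ≢ q) → ⌊ x ≟ p ⌋ ∧ ⌊ y ≟ q ⌋ ≡ false
  ∧-false (inj₁ x≢p) rewrite ≟-≢ x≢p = refl
  ∧-false {x = x} {p = p} (inj₂ y≢q) rewrite ≟-≢ y≢q = ∧-zeroʳ ⌊ x ≟ p ⌋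

samePair-unique : ∀ {N} {x y p q q' : Fin N} → p ≢ q → p ≢ q' →
                  samePair x y p q ≡ true → samePair x y p q' ≡ true → q ≡ q'
samePair-unique {x = x} {y} p≢q p≢q' xy≡pq xy≡pq' with samePair-true {x = x} {y} xy≡pq | samePair-true {x = x} {y} xy≡pq'
... | inj₁ (refl , refl) | inj₁ (_ , refl) = refl
... | inj₁ (refl , refl) | inj₂ (x≡q' , _) = ⊥-elim (p≢q' x≡q')
... | inj₂ (x≡q , _)     | inj₁ (refl , _) = ⊥-elim (p≢q x≡q)
... | inj₂ (refl , refl) | inj₂ (refl , _) = refl

∑-𝟙-∧-≟ : ∀ {N} c (q : Fin N) → ∑[ y < N ] 𝟙 (c ∧ ⌊ y ≟ q ⌋) ≡ 𝟙 c
∑-𝟙-∧-≟ c q = begin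
  ∑[ y < _ ] 𝟙 (c ∧ ⌊ y ≟ q ⌋)  ≡⟨ ∑-supportedAt (λ y → 𝟙 (c ∧ ⌊ y ≟ q ⌋)) q (λ y y≢q → cong (λ t → 𝟙 (c ∧ t)) (≟-≢ y≢q) ⟨ trans ⟩ cong 𝟙 (∧-zeroʳ c)) ⟩
  𝟙 (c ∧ ⌊ q ≟ q ⌋)              ≡⟨ cong (λ t → 𝟙 (c ∧ t)) (≟-≡ {x = q} refl) ⟩
  𝟙 (c ∧ true)                   ≡⟨ cong 𝟙 (∧-identityʳ c) ⟩
  𝟙 c                            ∎
  where open ≡-Reasoning

∑-samePair : ∀ {N} (x p q : Fin N) → p ≢ q →
             ∑[ y < N ] 𝟙 (samePair x y p q) ≡ 𝟙 ⌊ x ≟ p ⌋ + 𝟙 ⌊ x ≟ q ⌋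
∑-samePair x p q p≢q =
  trans (sum-cong-≗ λ y → 𝟙-∨ (⌊ x ≟ p ⌋ ∧ ⌊ y ≟ q ⌋) _ (not-both y))
        (trans (∑-distrib-+ (λ y → 𝟙 (⌊ x ≟ p ⌋ ∧ ⌊ y ≟ q ⌋)) (λ y → 𝟙 (⌊ x ≟ q ⌋ ∧ ⌊ y ≟ p ⌋))) (cong₂ _+_ (∑-𝟙-∧-≟ ⌊ x ≟ p ⌋ q) (∑-𝟙-∧-≟ ⌊ x ≟ q ⌋ p)))
  where
  not-both : ∀ y → ¬ (⌊ x ≟ p ⌋ ∧ ⌊ y ≟ q ⌋ ≡ true × ⌊ x ≟ q ⌋ ∧ ⌊ y ≟ p ⌋ ≡ true)
  not-both y (xy≡pq , xy≡qp) =
    p≢q (trans (sym (≟-true (proj₁ (∧-true xy≡pq)))) (≟-true (proj₁ (∧-true {⌊ x ≟ q ⌋} xy≡qp))))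

∑∑-samePair : ∀ {n} {p q : Fin n} → p ≢ q → ∀ x → ∑∑ (λ i j → 𝟙 (samePair i j p q ∧ i <ᶠ j) * x) ≡ x
∑∑-samePair {n} {p} {q} p≢q x = begin
  ∑∑ (λ i j → 𝟙 (samePair i j p q ∧ i <ᶠ j) * x)
    ≡⟨ ∑∑-cong _ _ split ⟩
  ∑∑ (λ i j → pick p q i j + pick q p i j)
    ≡⟨ ∑∑-distrib-+ (pick p q) (pick q p) ⟩
  ∑∑ (pick p q) + ∑∑ (pick q p)
    ≡⟨ cong₂ _+_ (at p q) (at q p) ⟩
  𝟙 (p <ᶠ q) * x + 𝟙 (q <ᶠ p) * x
    ≡⟨ *-distribʳ-+ x (𝟙 (p <ᶠ q)) _ ⟨
  (𝟙 (p <ᶠ q) + 𝟙 (q <ᶠ p)) * x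
    ≡⟨ cong (_* x) (one-way (toℕ p) (toℕ q) (p≢q ∘ Finₚ.toℕ-injective)) ⟩
  1 * x
    ≡⟨ *-identityˡ x ⟩
  x ∎
  where
  open ≡-Reasoning
  pick : Fin n → Fin n → Fin n → Fin n → ℕ
  pick p q i j = 𝟙 ((⌊ i ≟ p ⌋ ∧ ⌊ j ≟ q ⌋) ∧ i <ᶠ j) * x
  split : ∀ i j → 𝟙 (samePair i j p q ∧ i <ᶠ j) * x ≡ pick p q i j + pick q p i j
  split i j = trans (cong (λ c → 𝟙 c * x) (∧-distribʳ-∨ (i <ᶠ j) (⌊ i ≟ p ⌋ ∧ ⌊ j ≟ q ⌋) _))
    (trans (cong (_* x) (𝟙-∨ ((⌊ i ≟ p ⌋ ∧ ⌊ j ≟ q ⌋) ∧ i <ᶠ j) _ not-both)) (*-distribʳ-+ x (𝟙 ((⌊ i ≟ p ⌋ ∧ ⌊ j ≟ q ⌋) ∧ i <ᶠ j)) _))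
    where
    not-both : ¬ ((⌊ i ≟ p ⌋ ∧ ⌊ j ≟ q ⌋) ∧ i <ᶠ j ≡ true × (⌊ i ≟ q ⌋ ∧ ⌊ j ≟ p ⌋) ∧ i <ᶠ j ≡ true)
    not-both (ij≡pq , ij≡qp) = p≢q (trans (sym (≟-true (proj₁ (∧-true {⌊ i ≟ p ⌋} (proj₁ (∧-true {⌊ i ≟ p ⌋ ∧ ⌊ j ≟ q ⌋} ij≡pq))))))
                                          (≟-true (proj₁ (∧-true {⌊ i ≟ q ⌋} (proj₁ (∧-true {⌊ i ≟ q ⌋ ∧ ⌊ j ≟ p ⌋} ij≡qp))))))
  at : ∀ p q → ∑∑ (pick p q) ≡ 𝟙 (p <ᶠ q) * x
  at p q = trans (∑∑-supportedAt (pick p q) p q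
                   (λ i j i≢p → cong (λ c → 𝟙 ((c ∧ ⌊ j ≟ q ⌋) ∧ i <ᶠ j) * x) (≟-≢ i≢p))
                   (λ j j≢q → cong (λ c → 𝟙 ((⌊ p ≟ p ⌋ ∧ c) ∧ p <ᶠ j) * x) (≟-≢ j≢q)
                              ⟨ trans ⟩ cong (λ c → 𝟙 (c ∧ p <ᶠ j) * x) (∧-zeroʳ ⌊ p ≟ p ⌋)))
                 (cong₂ (λ c d → 𝟙 ((c ∧ d) ∧ p <ᶠ q) * x) (≟-≡ {x = p} refl) (≟-≡ {x = q} refl))
  one-way : ∀ a b → a ≢ b → 𝟙 (a <ᵇ b) + 𝟙 (b <ᵇ a) ≡ 1
  one-way a b a≢b with <-cmp a b
  ... | tri< a<b _ _ rewrite <ᵇ-true a<b | <ᵇ-false (<⇒≯ a<b) = refl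
  ... | tri≈ _ a≡b _ = ⊥-elim (a≢b a≡b)
  ... | tri> _ _ b<a rewrite <ᵇ-true b<a | <ᵇ-false (<⇒≯ b<a) = refl

moveEdge-≡ : ∀ {N} (G : AdjFn N) {p q r s} x y {c c'} → samePair x y p q ≡ c → samePair x y r s ≡ c' →
             moveEdge G p q r s x y ≡ (if c then false else if c' then true else G x y)
moveEdge-≡ G x y refl refl = refl

module _ {N} (G : AdjFn N) (G-sym : ∀ x y → G x y ≡ G y x) {p q r s : Fin N}
         (Gpq : G p q ≡ true) (Grs : G r s ≡ false) (p≢q : p ≢ q) (r≢s : r ≢ s) where

  private
    G' : AdjFn N
    G' = moveEdge G p q r s

    edge-of : ∀ x y {p q} → G p q ≡ true → samePair x y p q ≡ true → G x y ≡ true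
    edge-of x y Gpq eq with samePair-true {x = x} {y} eq
    ... | inj₁ (refl , refl) = Gpq
    ... | inj₂ (refl , refl) = trans (G-sym _ _) Gpq

    non-edge-of : ∀ x y {r s} → G r s ≡ false → samePair x y r s ≡ true → G x y ≡ false
    non-edge-of x y Grs eq with samePair-true {x = x} {y} eq
    ... | inj₁ (refl , refl) = Grs
    ... | inj₂ (refl , refl) = trans (G-sym _ _) Grs

    moved : ∀ x y → 𝟙 (G' x y) + 𝟙 (samePair x y p q) ≡ 𝟙 (G x y) + 𝟙 (samePair x y r s)
    moved x y with samePair x y p q in xy≡pq | samePair x y r s in xy≡rs
    ... | true  | true  with () ← trans (sym (edge-of x y Gpq xy≡pq)) (non-edge-of x y Grs xy≡rs)
    ... | true  | false rewrite edge-of x y Gpq xy≡pq = refl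
    ... | false | true  rewrite non-edge-of x y Grs xy≡rs = refl
    ... | false | false = refl

  deg-moveEdge : ∀ x → deg G' x + (𝟙 ⌊ x ≟ p ⌋ + 𝟙 ⌊ x ≟ q ⌋) ≡ deg G x + (𝟙 ⌊ x ≟ r ⌋ + 𝟙 ⌊ x ≟ s ⌋)
  deg-moveEdge x = begin
    deg G' x + (𝟙 ⌊ x ≟ p ⌋ + 𝟙 ⌊ x ≟ q ⌋)
      ≡⟨ cong₂ _+_ (deg≡∑ G' x) (sym (∑-samePair x p q p≢q)) ⟩
    ∑[ y < N ] 𝟙 (G' x y) + ∑[ y < N ] 𝟙 (samePair x y p q)
      ≡⟨ sym (∑-distrib-+ (λ y → 𝟙 (G' x y)) (λ y → 𝟙 (samePair x y p q))) ⟩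
    ∑[ y < N ] (𝟙 (G' x y) + 𝟙 (samePair x y p q))
      ≡⟨ sum-cong-≗ (moved x) ⟩
    ∑[ y < N ] (𝟙 (G x y) + 𝟙 (samePair x y r s))
      ≡⟨ ∑-distrib-+ (λ y → 𝟙 (G x y)) (λ y → 𝟙 (samePair x y r s)) ⟩
    ∑[ y < N ] 𝟙 (G x y) + ∑[ y < N ] 𝟙 (samePair x y r s)
      ≡⟨ cong₂ _+_ (sym (deg≡∑ G x)) (∑-samePair x r s r≢s) ⟩
    deg G x + (𝟙 ⌊ x ≟ r ⌋ + 𝟙 ⌊ x ≟ s ⌋) ∎
    where open ≡-Reasoning

-- Integer approximations of N/√s from below and above

private
  sq-mono-≤ : ∀ {a b} s → a ≤ b → a * a * s ≤ b * b * s
  sq-mono-≤ s a≤b = *-monoˡ-≤ s (*-mono-≤ a≤b a≤b)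

  sq-cancel-< : ∀ {a b} s → a * a * s < b * b * s → a < b
  sq-cancel-< {a} {b} s lt with a <? b
  ... | yes a<b = a<b
  ... | no  a≮b = ⊥-elim (<⇒≱ lt (sq-mono-≤ s (≮⇒≥ a≮b)))

  sq-cancel-≤ : ∀ {a b} s → 1 ≤ s → a * a * s ≤ b * b * s → a ≤ b
  sq-cancel-≤ {a} {b} s 1≤s le with b <? a
  ... | no  b≮a = ≮⇒≥ b≮a
  ... | yes b<a = ⊥-elim (<⇒≱ (*-monoˡ-< s {{>-nonZero 1≤s}} (*-mono-< b<a b<a)) le)

-- Opaque, since otherwise conversion checking unfolds the searches on open terms, which is
-- very slow; closed values are computed below by unfolding.
opaque
  private
    search : ℕ → ℕ → ℕ → ℕ
    search N s zero    = zero
    search N s (suc c) = if suc c * suc c * s ≤ᵇ N * N then suc c else search N s c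

    search-sound : ∀ N s c → search N s c * search N s c * s ≤ N * N
    search-sound N s zero    = z≤n
    search-sound N s (suc c) with suc c * suc c * s ≤ᵇ N * N in fits
    ... | true  = ≤ᵇ⇒≤ _ _ (≡true⇒T fits)
    ... | false = search-sound N s c

    search-greatest : ∀ N s c c' → c' ≤ c → c' * c' * s ≤ N * N → c' ≤ search N s c
    search-greatest N s zero    c' c'≤0 _ = c'≤0
    search-greatest N s (suc c) c' c'≤c fits with suc c * suc c * s ≤ᵇ N * N in test
    ... | true  = c'≤c
    ... | false with m≤n⇒m<n∨m≡n c'≤c
    ...   | inj₁ c'<1+c = search-greatest N s c c' (s≤s⁻¹ c'<1+c) fits
    ...   | inj₂ refl   = ⊥-elim (subst T test (≤⇒≤ᵇ fits))

  ⌊_/√_⌋ : ℕ → ℕ → ℕ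
  ⌊ N /√ s ⌋ = search N s N

  ⌈_/√_⌉ : ℕ → ℕ → ℕ
  ⌈ N /√ s ⌉ = if N * N ≤ᵇ ⌊ N /√ s ⌋ * ⌊ N /√ s ⌋ * s then ⌊ N /√ s ⌋ else suc ⌊ N /√ s ⌋

  ⌊/√⌋-sound : ∀ N s → ⌊ N /√ s ⌋ * ⌊ N /√ s ⌋ * s ≤ N * N
  ⌊/√⌋-sound N s = search-sound N s N

  ⌊/√⌋-greatest : ∀ N {s c} → 1 ≤ s → c * c * s ≤ N * N → c ≤ ⌊ N /√ s ⌋
  ⌊/√⌋-greatest N {s} {c} 1≤s fits = search-greatest N s N c c≤N fits
    where
    c≤N : c ≤ N
    c≤N = sq-cancel-≤ 1 ≤-refl (begin
      c * c * 1  ≡⟨ *-identityʳ (c * c) ⟩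
      c * c      ≤⟨ m≤m*n (c * c) s {{>-nonZero 1≤s}} ⟩
      c * c * s  ≤⟨ fits ⟩
      N * N      ≡⟨ *-identityʳ (N * N) ⟨
      N * N * 1  ∎)
      where open ≤-Reasoning

  ⌊/√⌋-antitone : ∀ N {s s'} → 1 ≤ s → s ≤ s' → ⌊ N /√ s' ⌋ ≤ ⌊ N /√ s ⌋
  ⌊/√⌋-antitone N {s} {s'} 1≤s s≤s' =
    ⌊/√⌋-greatest N 1≤s (≤-trans (*-monoʳ-≤ (⌊ N /√ s' ⌋ * ⌊ N /√ s' ⌋) s≤s') (⌊/√⌋-sound N s'))

  ⌈/√⌉-sound : ∀ N {s} → 1 ≤ s → N * N ≤ ⌈ N /√ s ⌉ * ⌈ N /√ s ⌉ * s
  ⌈/√⌉-sound N {s} 1≤s with N * N ≤ᵇ ⌊ N /√ s ⌋ * ⌊ N /√ s ⌋ * s in covers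
  ... | true  = ≤ᵇ⇒≤ _ _ (≡true⇒T covers)
  ... | false with suc ⌊ N /√ s ⌋ * suc ⌊ N /√ s ⌋ * s ≤? N * N
  ...   | no  >N = <⇒≤ (≰⇒> >N)
  ...   | yes ≤N = ⊥-elim (1+n≰n (⌊/√⌋-greatest N 1≤s ≤N))

  ⌈/√⌉-least : ∀ N {s c} → 1 ≤ s → N * N ≤ c * c * s → ⌈ N /√ s ⌉ ≤ c
  ⌈/√⌉-least N {s} {c} 1≤s covers with N * N ≤ᵇ ⌊ N /√ s ⌋ * ⌊ N /√ s ⌋ * s in test
  ... | true  = sq-cancel-≤ s 1≤s (≤-trans (⌊/√⌋-sound N s) covers)
  ... | false = sq-cancel-< s (<-≤-trans (≰⇒> (λ ≤⌊⌋ → subst T test (≤⇒≤ᵇ ≤⌊⌋))) covers)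

  ⌈/√⌉≤1+⌊/√⌋ : ∀ N {s s'} → 1 ≤ s → s ≤ s' → ⌈ N /√ s' ⌉ ≤ suc ⌊ N /√ s ⌋
  ⌈/√⌉≤1+⌊/√⌋ N {s} {s'} 1≤s s≤s' = ≤-trans ⌈⌉≤1+⌊⌋ (s≤s (⌊/√⌋-antitone N 1≤s s≤s'))
    where
    ⌈⌉≤1+⌊⌋ : ⌈ N /√ s' ⌉ ≤ suc ⌊ N /√ s' ⌋
    ⌈⌉≤1+⌊⌋ with N * N ≤ᵇ ⌊ N /√ s' ⌋ * ⌊ N /√ s' ⌋ * s'
    ... | true  = n≤1+n _
    ... | false = ≤-refl

private
  *-square-distrib : ∀ a k s → (a * k) * (a * k) * s ≡ (a * a * s) * (k * k)
  *-square-distrib = solve-∀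

  *-square : ∀ a k → (a * k) * (a * k) ≡ (a * a) * (k * k)
  *-square = solve-∀

⌊/√⌋-scale : ∀ Q K s → 1 ≤ s → ⌊ Q /√ s ⌋ * K ≤ ⌊ Q * K /√ s ⌋
⌊/√⌋-scale Q K s 1≤s = ⌊/√⌋-greatest (Q * K) 1≤s (begin
  (⌊ Q /√ s ⌋ * K) * (⌊ Q /√ s ⌋ * K) * s  ≡⟨ *-square-distrib ⌊ Q /√ s ⌋ K s ⟩
  (⌊ Q /√ s ⌋ * ⌊ Q /√ s ⌋ * s) * (K * K)  ≤⟨ *-monoˡ-≤ (K * K) (⌊/√⌋-sound Q s) ⟩
  (Q * Q) * (K * K)                        ≡⟨ *-square Q K ⟨
  (Q * K) * (Q * K)                        ∎)
  where open ≤-Reasoning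

⌈/√⌉-scale : ∀ Q K s → 1 ≤ s → ⌈ Q * K /√ s ⌉ ≤ ⌈ Q /√ s ⌉ * K
⌈/√⌉-scale Q K s 1≤s = ⌈/√⌉-least (Q * K) 1≤s (begin
  (Q * K) * (Q * K)                        ≡⟨ *-square Q K ⟩
  (Q * Q) * (K * K)                        ≤⟨ *-monoˡ-≤ (K * K) (⌈/√⌉-sound Q 1≤s) ⟩
  (⌈ Q /√ s ⌉ * ⌈ Q /√ s ⌉ * s) * (K * K)  ≡⟨ *-square-distrib ⌈ Q /√ s ⌉ K s ⟨
  (⌈ Q /√ s ⌉ * K) * (⌈ Q /√ s ⌉ * K) * s  ∎)
  where open ≤-Reasoning

_/1+_ : ℕ → ℕ → ℚ
a /1+ d = ℤ.+ a ℚ./ suc d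

module _ (d : ℕ) where

  private
    N : ℕ
    N = suc d

    ≃-/1+ : ∀ a → toℚᵘ (a /1+ d) ℚᵘ.≃ mkℚᵘ (ℤ.+ a) d
    ≃-/1+ a = toℚᵘ-fromℚᵘ (mkℚᵘ (ℤ.+ a) d)

    ≃-square : ∀ a s → toℚᵘ ((a /1+ d ℚ.* a /1+ d) ℚ.* ℕtoℚ s) ℚᵘ.≃ (mkℚᵘ (ℤ.+ a) d ℚᵘ.* mkℚᵘ (ℤ.+ a) d) ℚᵘ.* mkℚᵘ (ℤ.+ s) 0
    ≃-square a s = ℚᵘ.≃-trans (toℚᵘ-homo-* (a /1+ d ℚ.* a /1+ d) (ℕtoℚ s))
      (ℚᵘ.*-cong (ℚᵘ.≃-trans (toℚᵘ-homo-* (a /1+ d) (a /1+ d)) (ℚᵘ.*-cong (≃-/1+ a) (≃-/1+ a))) (toℚᵘ-fromℚᵘ _))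

    ↥1≡ : ℤ.+ (N * N) ≡ ℤ.+ 1 ℤ.* ℤ.+ (N * N * 1)
    ↥1≡ = trans (cong ℤ.+_ (sym (*-identityʳ _))) (sym (ℤ.*-identityˡ _))

    ↥square≡ : ∀ a s → ℤ.+ (a * a * s) ≡ ((ℤ.+ a ℤ.* ℤ.+ a) ℤ.* ℤ.+ s) ℤ.* ℤ.+ 1
    ↥square≡ a s = trans (trans (ℤ.pos-* (a * a) s) (cong (ℤ._* ℤ.+ s) (ℤ.pos-* a a))) (sym (ℤ.*-identityʳ _))

  /1+-upper : ∀ a s → N * N ≤ a * a * s → UpperInvSqrt s (a /1+ d)
  /1+-upper a s covers =
    toℚᵘ-cancel-≤ (ℚᵘ.≤-respʳ-≃ (ℚᵘ.≃-sym (≃-/1+ a)) (*≤* (subst (ℤ._≤_ _) (sym (ℤ.*-identityʳ (ℤ.+ a))) (ℤ.+≤+ z≤n)))) ,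
    toℚᵘ-cancel-≤ (ℚᵘ.≤-respʳ-≃ (ℚᵘ.≃-sym (≃-square a s)) (*≤* (subst₂ ℤ._≤_ ↥1≡ (↥square≡ a s) (ℤ.+≤+ covers))))

  /1+-lower : ∀ a s → a * a * s ≤ N * N → LowerInvSqrt s (a /1+ d)
  /1+-lower a s fits =
    inj₂ (toℚᵘ-cancel-≤ (ℚᵘ.≤-respˡ-≃ (ℚᵘ.≃-sym (≃-square a s)) (*≤* (subst₂ ℤ._≤_ (↥square≡ a s) ↥1≡ (ℤ.+≤+ fits)))))

  /1+-<-mono : ∀ {a b} → a < b → a /1+ d ℚ.< b /1+ d
  /1+-<-mono {a} {b} a<b = toℚᵘ-cancel-< (ℚᵘ.<-respˡ-≃ (ℚᵘ.≃-sym (≃-/1+ a)) (ℚᵘ.<-respʳ-≃ (ℚᵘ.≃-sym (≃-/1+ b))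
    (*<* (subst₂ ℤ._<_ (ℤ.pos-* a N) (ℤ.pos-* b N) (ℤ.+<+ (*-monoˡ-< N a<b))))))

  /1+-+ : ∀ a b → a /1+ d ℚ.+ b /1+ d ≡ (a + b) /1+ d
  /1+-+ a b = toℚᵘ-injective (ℚᵘ.≃-trans (toℚᵘ-homo-+ (a /1+ d) (b /1+ d))
    (ℚᵘ.≃-trans (ℚᵘ.+-cong (≃-/1+ a) (≃-/1+ b)) (ℚᵘ.≃-trans (*≡* cross) (ℚᵘ.≃-sym (≃-/1+ (a + b))))))
    where
    distrib : ∀ (x y z : ℤ) → (x ℤ.* z ℤ.+ y ℤ.* z) ℤ.* z ≡ (x ℤ.+ y) ℤ.* (z ℤ.* z)
    distrib = ℤSolver.solve-∀
    cross : (ℤ.+ a ℤ.* ℤ.+ N ℤ.+ ℤ.+ b ℤ.* ℤ.+ N) ℤ.* ℤ.+ N ≡ ℤ.+ (a + b) ℤ.* ℤ.+ (N * N)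
    cross = trans (distrib (ℤ.+ a) (ℤ.+ b) (ℤ.+ N)) (cong₂ ℤ._*_ (sym (ℤ.pos-+ a b)) (sym (ℤ.pos-* N N)))

  sumℚ-/1+ : ∀ (f : ℕ → ℕ) xs → sumℚ (map (λ s → f s /1+ d) xs) ≡ ListAction.sum (map f xs) /1+ d
  sumℚ-/1+ f []       = toℚᵘ-injective (ℚᵘ.≃-sym (ℚᵘ.≃-trans (≃-/1+ 0) (*≡* refl)))
  sumℚ-/1+ f (x ∷ xs) = trans (cong (f x /1+ d ℚ.+_) (sumℚ-/1+ f xs)) (/1+-+ (f x) _)

χ-<-by-approximation : ∀ {V V'} (G : AdjFn V) (G' : AdjFn V') N .{{_ : NonZero N}} →
                       ∑ᴱ G ⌈ N /√_⌉ < ∑ᴱ G' ⌊ N /√_⌋ → χ-< G G'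
χ-<-by-approximation G G' N@(suc d) approx<approx =
  map (λ s → ⌈ N /√ s ⌉ /1+ d) (edgeDegSums G) , map (λ s → ⌊ N /√ s ⌋ /1+ d) (edgeDegSums G') ,
  uppers (edgeDegSums G) (edgeDegSums-pos G) , lowers (edgeDegSums G') ,
  subst₂ ℚ._<_ (sym (sumℚ-/1+ d ⌈ N /√_⌉ (edgeDegSums G))) (sym (sumℚ-/1+ d ⌊ N /√_⌋ (edgeDegSums G')))
    (/1+-<-mono d approx<approx)
  where
  uppers : ∀ xs → All (1 ≤_) xs → Pointwise UpperInvSqrt xs (map (λ s → ⌈ N /√ s ⌉ /1+ d) xs)
  uppers []       []           = []
  uppers (s ∷ xs) (1≤s ∷ 1≤xs) = /1+-upper d ⌈ N /√ s ⌉ s (⌈/√⌉-sound N 1≤s) ∷ uppers xs 1≤xs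

  lowers : ∀ xs → Pointwise LowerInvSqrt xs (map (λ s → ⌊ N /√ s ⌋ /1+ d) xs)
  lowers []       = []
  lowers (s ∷ xs) = /1+-lower d ⌊ N /√ s ⌋ s (⌊/√⌋-sound N s) ∷ lowers xs

∑-≡ᵇ : ∀ m t → ∑[ l < m ] 𝟙 (t ≡ᵇ toℕ l) ≡ 𝟙 (t <ᵇ m)
∑-≡ᵇ zero    t       = refl
∑-≡ᵇ (suc m) zero    = cong suc (∑-zero (λ (l : Fin m) → 𝟙 (0 ≡ᵇ suc (toℕ l))) λ _ → refl)
∑-≡ᵇ (suc m) (suc t) = ∑-≡ᵇ m t

∑-≡ᵇ′ : ∀ m t → ∑[ l < m ] 𝟙 (toℕ l ≡ᵇ t) ≡ 𝟙 (t <ᵇ m)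
∑-≡ᵇ′ zero    t       = refl
∑-≡ᵇ′ (suc m) zero    = cong suc (∑-zero (λ (l : Fin m) → 𝟙 (suc (toℕ l) ≡ᵇ 0)) λ _ → refl)
∑-≡ᵇ′ (suc m) (suc t) = ∑-≡ᵇ′ m t

pathAdj : ∀ {b} → Fin (suc b) → Fin (suc b) → Bool
pathAdj k l = (suc (toℕ k) ≡ᵇ toℕ l) ∨ (suc (toℕ l) ≡ᵇ toℕ k)

path-deg : ∀ b t → t ≤ b →
           𝟙 (t ≡ᵇ 0) + ∑[ l < suc b ] 𝟙 ((suc t ≡ᵇ toℕ l) ∨ (suc (toℕ l) ≡ᵇ t)) ≡ suc (𝟙 (t <ᵇ b))
path-deg b t t≤b = begin
  𝟙 (t ≡ᵇ 0) + ∑[ l < suc b ] 𝟙 ((suc t ≡ᵇ toℕ l) ∨ (suc (toℕ l) ≡ᵇ t))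
    ≡⟨ cong (𝟙 (t ≡ᵇ 0) +_) (trans (sum-cong-≗ {suc b} λ l → 𝟙-∨ (suc t ≡ᵇ toℕ l) _ (not-both l))
                                   (∑-distrib-+ {suc b} (λ l → 𝟙 (suc t ≡ᵇ toℕ l)) (λ l → 𝟙 (suc (toℕ l) ≡ᵇ t)))) ⟩
  𝟙 (t ≡ᵇ 0) + (∑[ l < suc b ] 𝟙 (suc t ≡ᵇ toℕ l) + ∑[ l < suc b ] 𝟙 (suc (toℕ l) ≡ᵇ t))
    ≡⟨ cong (λ x → 𝟙 (t ≡ᵇ 0) + (x + ∑[ l < suc b ] 𝟙 (suc (toℕ l) ≡ᵇ t))) (∑-≡ᵇ (suc b) (suc t)) ⟩
  𝟙 (t ≡ᵇ 0) + (𝟙 (t <ᵇ b) + ∑[ l < suc b ] 𝟙 (suc (toℕ l) ≡ᵇ t))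
    ≡⟨ ends t t≤b ⟩
  suc (𝟙 (t <ᵇ b)) ∎
  where
  open ≡-Reasoning
  not-both : ∀ l → ¬ ((suc t ≡ᵇ toℕ l) ≡ true × (suc (toℕ l) ≡ᵇ t) ≡ true)
  not-both l (t+1≡l , l+1≡t) = 1+n≰n (≤-trans (n≤1+n (suc t)) (≤-reflexive
    (trans (cong suc (≡ᵇ⇒≡ _ _ (≡true⇒T t+1≡l))) (≡ᵇ⇒≡ _ _ (≡true⇒T l+1≡t)))))
  ends : ∀ t → t ≤ b → 𝟙 (t ≡ᵇ 0) + (𝟙 (t <ᵇ b) + ∑[ l < suc b ] 𝟙 (suc (toℕ l) ≡ᵇ t)) ≡ suc (𝟙 (t <ᵇ b))
  ends zero    _   = cong suc (trans (cong (𝟙 (0 <ᵇ b) +_) (∑-zero (λ l → 𝟙 (suc (toℕ {suc b} l) ≡ᵇ 0)) λ _ → refl)) (+-identityʳ _))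
  ends (suc t) t<b rewrite ∑-≡ᵇ′ (suc b) t | <ᵇ-true (≤-trans t<b (n≤1+n b)) = +-comm (𝟙 (suc t <ᵇ b)) 1

pathEdge : ∀ {b} → Fin (suc b) → Fin (suc b) → Bool
pathEdge k l = pathAdj k l ∧ k <ᶠ l

pathEdge-suc : ∀ {b} (k l : Fin (suc b)) → pathEdge k l ≡ true → suc (toℕ k) ≡ toℕ l
pathEdge-suc k l kl with ∧-true {pathAdj k l} kl
... | adj , k<l with ∨-true {suc (toℕ k) ≡ᵇ toℕ l} adj
...   | inj₁ 1+k≡l = ≡ᵇ⇒≡ _ _ (≡true⇒T 1+k≡l)
...   | inj₂ 1+l≡k = ⊥-elim (<-asym (<ᵇ⇒< (toℕ k) (toℕ l) (≡true⇒T k<l)) (≤-reflexive (≡ᵇ⇒≡ (suc (toℕ l)) (toℕ k) (≡true⇒T 1+l≡k))))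

∑∑-pathEdge-into-last : ∀ b v → ∑∑ (λ (k l : Fin (suc b)) → if pathEdge k l ∧ ⌊ l ≟ fromℕ b ⌋ then v else 0) ≡ 𝟙 (0 <ᵇ b) * v
∑∑-pathEdge-into-last zero     v = refl
∑∑-pathEdge-into-last (suc b') v = begin
  ∑∑ into-last                                    ≡⟨ ∑∑-supportedAt into-last penultimate last (λ k l → off k l) off-last ⟩
  into-last penultimate last                      ≡⟨ cong (λ c → if c then v else 0) hit ⟩
  v                                               ≡⟨ +-identityʳ v ⟨
  1 * v                                           ∎
  where
  open ≡-Reasoning
  last penultimate : Fin (suc (suc b'))
  last        = fromℕ (suc b')
  penultimate = inject₁ (fromℕ b')
  toℕ-penultimate : toℕ penultimate ≡ b'
  toℕ-penultimate = trans (Finₚ.toℕ-inject₁ (fromℕ b')) (Finₚ.toℕ-fromℕ b')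
  into-last : Fin (suc (suc b')) → Fin (suc (suc b')) → ℕ
  into-last k l = if pathEdge k l ∧ ⌊ l ≟ last ⌋ then v else 0
  off : ∀ k l → k ≢ penultimate → into-last k l ≡ 0
  off k l k≢pen with pathEdge k l in kl | ⌊ l ≟ last ⌋ in l≡last
  ... | false | _     = refl
  ... | true  | false = refl
  ... | true  | true  = ⊥-elim (k≢pen (Finₚ.toℕ-injective (trans (suc-injective
          (trans (pathEdge-suc k l kl) (trans (cong toℕ (≟-true l≡last)) (Finₚ.toℕ-fromℕ (suc b'))))) (sym toℕ-penultimate))))
  off-last : ∀ l → l ≢ last → into-last penultimate l ≡ 0
  off-last l l≢last rewrite ≟-≢ l≢last | ∧-zeroʳ (pathEdge penultimate l) = refl
  hit : pathEdge penultimate last ∧ ⌊ last ≟ last ⌋ ≡ true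
  hit rewrite ≟-≡ {x = last} refl | toℕ-penultimate | Finₚ.toℕ-fromℕ b' | T⇒≡true (≡⇒≡ᵇ b' b' refl) | <ᵇ-true (n<1+n b') = refl

module AttachedPath {n} (M : AdjFn n) (u : Fin n) (b : ℕ) where

  H : AdjFn (n + suc b)
  H = attachPath M u b

  old : Fin n → Fin (n + suc b)
  old i = i ↑ˡ suc b

  new : Fin (suc b) → Fin (n + suc b)
  new k = n ↑ʳ k

  anchorEdge : Fin n → Fin (suc b) → Bool
  anchorEdge i k = ⌊ i ≟ u ⌋ ∧ (toℕ k ≡ᵇ 0)

  H-old-old : ∀ i j → H (old i) (old j) ≡ M i j
  H-old-old i j rewrite Finₚ.splitAt-↑ˡ n i (suc b) | Finₚ.splitAt-↑ˡ n j (suc b) = refl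

  H-old-new : ∀ i k → H (old i) (new k) ≡ anchorEdge i k
  H-old-new i k rewrite Finₚ.splitAt-↑ˡ n i (suc b) | Finₚ.splitAt-↑ʳ n (suc b) k = refl

  H-new-old : ∀ k i → H (new k) (old i) ≡ anchorEdge i k
  H-new-old k i rewrite Finₚ.splitAt-↑ˡ n i (suc b) | Finₚ.splitAt-↑ʳ n (suc b) k = refl

  H-new-new : ∀ k l → H (new k) (new l) ≡ pathAdj k l
  H-new-new k l rewrite Finₚ.splitAt-↑ʳ n (suc b) k | Finₚ.splitAt-↑ʳ n (suc b) l = refl

  H-sym : (∀ i j → M i j ≡ M j i) → ∀ x y → H x y ≡ H y x
  H-sym M-sym x y with splitAt n x | splitAt n y
  ... | inj₁ i | inj₁ j = M-sym i j
  ... | inj₁ i | inj₂ k = refl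
  ... | inj₂ k | inj₁ i = refl
  ... | inj₂ k | inj₂ l = ∨-comm (suc (toℕ k) ≡ᵇ toℕ l) _

  old-injective : ∀ {i j} → old i ≡ old j → i ≡ j
  old-injective = Finₚ.↑ˡ-injective (suc b) _ _

  new-injective : ∀ {k l} → new k ≡ new l → k ≡ l
  new-injective = Finₚ.↑ʳ-injective n _ _

  old<new : ∀ i k → toℕ (old i) < toℕ (new k)
  old<new i k = subst₂ _<_ (sym (Finₚ.toℕ-↑ˡ i (suc b))) (sym (Finₚ.toℕ-↑ʳ n k))
                      (≤-trans (Finₚ.toℕ<n i) (m≤m+n n (toℕ k)))

  old≢new : ∀ i k → old i ≢ new k
  old≢new i k eq = <⇒≢ (old<new i k) (cong toℕ eq)

  deg-H-old : ∀ i → deg H (old i) ≡ deg M i + 𝟙 ⌊ i ≟ u ⌋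
  deg-H-old i = begin
    deg H (old i)
      ≡⟨ deg≡∑ H (old i) ⟩
    ∑[ y < n + suc b ] 𝟙 (H (old i) y)
      ≡⟨ ∑-↑ n (suc b) (λ y → 𝟙 (H (old i) y)) ⟩
    ∑[ j < n ] 𝟙 (H (old i) (old j)) + ∑[ k < suc b ] 𝟙 (H (old i) (new k))
      ≡⟨ cong₂ _+_ (sum-cong-≗ {n} λ j → cong 𝟙 (H-old-old i j)) (sum-cong-≗ {suc b} λ k → cong 𝟙 (H-old-new i k)) ⟩
    ∑[ j < n ] 𝟙 (M i j) + ∑[ k < suc b ] 𝟙 (anchorEdge i k)
      ≡⟨ cong₂ _+_ (sym (deg≡∑ M i)) anchorEdge-count ⟩
    deg M i + 𝟙 ⌊ i ≟ u ⌋ ∎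
    where
    open ≡-Reasoning
    anchorEdge-count : ∑[ k < suc b ] 𝟙 (anchorEdge i k) ≡ 𝟙 ⌊ i ≟ u ⌋
    anchorEdge-count = trans (∑-supportedAt (λ k → 𝟙 (anchorEdge i k)) fzero λ where
                         fzero     0≢0 → ⊥-elim (0≢0 refl)
                         (fsuc k)  _   → cong 𝟙 (∧-zeroʳ ⌊ i ≟ u ⌋))
                      (cong 𝟙 (∧-identityʳ ⌊ i ≟ u ⌋))

  deg-H-new : ∀ k → deg H (new k) ≡ suc (𝟙 (toℕ k <ᵇ b))
  deg-H-new k = begin
    deg H (new k)
      ≡⟨ deg≡∑ H (new k) ⟩
    ∑[ y < n + suc b ] 𝟙 (H (new k) y)
      ≡⟨ ∑-↑ n (suc b) (λ y → 𝟙 (H (new k) y)) ⟩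
    ∑[ j < n ] 𝟙 (H (new k) (old j)) + ∑[ l < suc b ] 𝟙 (H (new k) (new l))
      ≡⟨ cong₂ _+_ (sum-cong-≗ {n} λ j → cong 𝟙 (trans (H-new-old k j) (∧-comm ⌊ j ≟ u ⌋ _)))
                   (sum-cong-≗ {suc b} λ l → cong 𝟙 (H-new-new k l)) ⟩
    ∑[ j < n ] 𝟙 ((toℕ k ≡ᵇ 0) ∧ ⌊ j ≟ u ⌋) + ∑[ l < suc b ] 𝟙 (pathAdj k l)
      ≡⟨ cong (_+ ∑[ l < suc b ] 𝟙 (pathAdj k l)) (∑-𝟙-∧-≟ (toℕ k ≡ᵇ 0) u) ⟩
    𝟙 (toℕ k ≡ᵇ 0) + ∑[ l < suc b ] 𝟙 (pathAdj k l)
      ≡⟨ path-deg b (toℕ k) (s≤s⁻¹ (Finₚ.toℕ<n k)) ⟩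
    suc (𝟙 (toℕ k <ᵇ b)) ∎
    where open ≡-Reasoning

module MovedEdge {n} (M : AdjFn n) (M-sym : ∀ i j → M i j ≡ M j i)
                 {u u₂ : Fin n} (u≢u₂ : u ≢ u₂) (Muu₂ : M u u₂ ≡ true) (b : ℕ) where

  open AttachedPath M u b public

  last : Fin (suc b)
  last = fromℕ b

  H' : AdjFn (n + suc b)
  H' = moveEdge H (old u) (old u₂) (new last) (old u₂)

  private
    ≟-old : ∀ i j → ⌊ old i ≟ old j ⌋ ≡ ⌊ i ≟ j ⌋
    ≟-old = ≟-injective old old-injective

    ≟-new : ∀ k l → ⌊ new k ≟ new l ⌋ ≡ ⌊ k ≟ l ⌋
    ≟-new = ≟-injective new new-injective

    new≢old : ∀ k i → new k ≢ old i
    new≢old k i = old≢new i k ∘ sym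

  H'-old-old : ∀ i j → H' (old i) (old j) ≡ (if samePair i j u u₂ then false else M i j)
  H'-old-old i j =
    trans (moveEdge-≡ H (old i) (old j) (samePair-injective old old-injective i j u u₂)
                                        (samePair-false (inj₁ (old≢new i last)) (inj₂ (old≢new j last))))
          (cong (if samePair i j u u₂ then false else_) (H-old-old i j))

  H'-old-new : ∀ i k → H' (old i) (new k) ≡ (if ⌊ i ≟ u₂ ⌋ ∧ ⌊ k ≟ last ⌋ then true else anchorEdge i k)
  H'-old-new i k =
    trans (moveEdge-≡ H (old i) (new k) (samePair-false {x = old i} (inj₂ (new≢old k u₂)) (inj₂ (new≢old k u)))
            (cong₂ _∨_ (cong (_∧ ⌊ new k ≟ old u₂ ⌋) (≟-≢ (old≢new i last)))
                       (cong₂ _∧_ (≟-old i u₂) (≟-new k last))))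
          (cong (if ⌊ i ≟ u₂ ⌋ ∧ ⌊ k ≟ last ⌋ then true else_) (H-old-new i k))

  H'-new-new : ∀ k l → H' (new k) (new l) ≡ pathAdj k l
  H'-new-new k l =
    trans (moveEdge-≡ H (new k) (new l) (samePair-false (inj₁ (new≢old k u)) (inj₁ (new≢old k u₂)))
                                        (samePair-false (inj₂ (new≢old l u₂)) (inj₁ (new≢old k u₂))))
          (H-new-new k l)

  private
    H'-deg-identity : ∀ x → deg H' x + (𝟙 ⌊ x ≟ old u ⌋ + 𝟙 ⌊ x ≟ old u₂ ⌋)
                          ≡ deg H x + (𝟙 ⌊ x ≟ new last ⌋ + 𝟙 ⌊ x ≟ old u₂ ⌋)
    H'-deg-identity = deg-moveEdge H (H-sym M-sym) (trans (H-old-old u u₂) Muu₂)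
      (trans (H-new-old last u₂) (cong (_∧ (toℕ last ≡ᵇ 0)) (≟-≢ (u≢u₂ ∘ sym))))
      (u≢u₂ ∘ old-injective) (new≢old last u₂)

  deg-H'-old : ∀ i → deg H' (old i) ≡ deg M i
  deg-H'-old i = +-cancelʳ-≡ (𝟙 ⌊ i ≟ u ⌋ + 𝟙 ⌊ i ≟ u₂ ⌋) _ _ (begin
    deg H' (old i) + (𝟙 ⌊ i ≟ u ⌋ + 𝟙 ⌊ i ≟ u₂ ⌋)
      ≡⟨ cong (deg H' (old i) +_) (cong₂ _+_ (cong 𝟙 (≟-old i u)) (cong 𝟙 (≟-old i u₂))) ⟨
    deg H' (old i) + (𝟙 ⌊ old i ≟ old u ⌋ + 𝟙 ⌊ old i ≟ old u₂ ⌋)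
      ≡⟨ H'-deg-identity (old i) ⟩
    deg H (old i) + (𝟙 ⌊ old i ≟ new last ⌋ + 𝟙 ⌊ old i ≟ old u₂ ⌋)
      ≡⟨ cong₂ _+_ (deg-H-old i) (cong₂ _+_ (cong 𝟙 (≟-≢ (old≢new i last))) (cong 𝟙 (≟-old i u₂))) ⟩
    deg M i + 𝟙 ⌊ i ≟ u ⌋ + 𝟙 ⌊ i ≟ u₂ ⌋
      ≡⟨ +-assoc (deg M i) _ _ ⟩
    deg M i + (𝟙 ⌊ i ≟ u ⌋ + 𝟙 ⌊ i ≟ u₂ ⌋) ∎)
    where open ≡-Reasoning

  deg-H'-new : ∀ k → deg H' (new k) ≡ 2
  deg-H'-new k = begin
    deg H' (new k)
      ≡⟨ +-identityʳ _ ⟨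
    deg H' (new k) + (0 + 0)
      ≡⟨ cong (deg H' (new k) +_) (cong₂ _+_ (cong 𝟙 (≟-≢ (new≢old k u))) (cong 𝟙 (≟-≢ (new≢old k u₂)))) ⟨
    deg H' (new k) + (𝟙 ⌊ new k ≟ old u ⌋ + 𝟙 ⌊ new k ≟ old u₂ ⌋)
      ≡⟨ H'-deg-identity (new k) ⟩
    deg H (new k) + (𝟙 ⌊ new k ≟ new last ⌋ + 𝟙 ⌊ new k ≟ old u₂ ⌋)
      ≡⟨ cong₂ _+_ (deg-H-new k) (cong₂ _+_ (cong 𝟙 (≟-new k last)) (cong 𝟙 (≟-≢ (new≢old k u₂)))) ⟩
    suc (𝟙 (toℕ k <ᵇ b)) + (𝟙 ⌊ k ≟ last ⌋ + 0)
      ≡⟨ cong suc (cong (𝟙 (toℕ k <ᵇ b) +_) (+-identityʳ _)) ⟩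
    suc (𝟙 (toℕ k <ᵇ b) + 𝟙 ⌊ k ≟ last ⌋)
      ≡⟨ cong suc (inner-or-last k) ⟩
    2 ∎
    where
    open ≡-Reasoning
    inner-or-last : ∀ k → 𝟙 (toℕ k <ᵇ b) + 𝟙 ⌊ k ≟ last ⌋ ≡ 1
    inner-or-last k with toℕ k <? b
    ... | yes k<b rewrite <ᵇ-true k<b = cong (1 +_) (cong 𝟙 (≟-≢ λ k≡last → <-irrefl (trans (cong toℕ k≡last) (Finₚ.toℕ-fromℕ b)) k<b))
    ... | no  k≮b rewrite <ᵇ-false k≮b = cong 𝟙 (≟-≡ (Finₚ.toℕ-injective (trans k≡b (sym (Finₚ.toℕ-fromℕ b)))))
      where
      k≡b : toℕ k ≡ b
      k≡b = ≤-antisym (s≤s⁻¹ (Finₚ.toℕ<n k)) (≮⇒≥ k≮b)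

-- Comparing χ(H) and χ(H')

-- In units of 1/N, spend bounds from above the H-weights of uu₂ and of the edge from u to the
-- path, plus (if b > 0) the excess of the last path edge over 1/2; gain bounds from below the
-- H'-weights of the edge from u to the path and of u₂u', plus the increase on uu₁.
spend : ℕ → ℕ → ℕ → ℕ → ℕ
spend N du d₂ β = ⌈ N /√ suc (du + d₂) ⌉ + ⌈ N /√ (du + 1 + suc β) ⌉ + β * (⌈ N /√ 3 ⌉ ∸ ⌊ N /√ 4 ⌋)

gain : ℕ → ℕ → ℕ → ℕ → ℕ
gain N du d₁ d₂ = (⌊ N /√ (du + d₁) ⌋ ∸ ⌈ N /√ suc (du + d₁) ⌉) + (⌊ N /√ (du + 2) ⌋ + ⌊ N /√ (d₂ + 2) ⌋)

module Accounting {n} (M : AdjFn n) (M-sym : ∀ i j → M i j ≡ M j i)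
                  {u u₁ u₂ : Fin n} (u≢u₁ : u ≢ u₁) (u≢u₂ : u ≢ u₂) (u₁≢u₂ : u₁ ≢ u₂)
                  (Muu₁ : M u u₁ ≡ true) (Muu₂ : M u u₂ ≡ true) (b : ℕ) (N : ℕ) where

  open MovedEdge M M-sym u≢u₂ Muu₂ b public

  w⁺ w⁻ : ℕ → ℕ
  w⁺ s = ⌈ N /√ s ⌉
  w⁻ s = ⌊ N /√ s ⌋

  d : Fin n → ℕ
  d = deg M

  raised : Fin n → ℕ
  raised i = d i + 𝟙 ⌊ i ≟ u ⌋

  raised-pair : ∀ {v} → M u v ≡ true → v ≢ u → ∀ i j → samePair i j u v ≡ true →
                M i j ≡ true × raised i + raised j ≡ suc (d u + d v) × d i + d j ≡ d u + d v
  raised-pair {v} Muv v≢u i j ij≡uv with samePair-true {x = i} {j} ij≡uv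
  ... | inj₁ (refl , refl) rewrite ≟-≡ {x = u} refl | ≟-≢ v≢u = Muv , uv (d u) (d v) , refl
    where
    uv : ∀ x y → x + 1 + (y + 0) ≡ suc (x + y)
    uv = solve-∀
  ... | inj₂ (refl , refl) rewrite ≟-≡ {x = u} refl | ≟-≢ v≢u = trans (M-sym v u) Muv , vu (d u) (d v) , +-comm (d v) (d u)
    where
    vu : ∀ x y → y + 0 + (x + 1) ≡ suc (x + y)
    vu = solve-∀

  gain₁ lost₂ : ℕ
  gain₁ = w⁻ (d u + d u₁) ∸ w⁺ (suc (d u + d u₁))
  lost₂ = w⁺ (suc (d u + d u₂))

  old-old-step : ∀ i j →
      (if M i j ∧ i <ᶠ j then w⁺ (raised i + raised j) else 0) + 𝟙 (samePair i j u u₁ ∧ i <ᶠ j) * gain₁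
    ≤ (if (if samePair i j u u₂ then false else M i j) ∧ i <ᶠ j then w⁻ (d i + d j) else 0)
      + (𝟙 (M i j ∧ i <ᶠ j) + 𝟙 (samePair i j u u₂ ∧ i <ᶠ j) * lost₂)
  old-old-step i j with samePair i j u u₂ in ij≡uu₂ | samePair i j u u₁ in ij≡uu₁
  ... | true  | true  = ⊥-elim (u₁≢u₂ (samePair-unique {x = i} {j} u≢u₁ u≢u₂ ij≡uu₁ ij≡uu₂))
  ... | true  | false with raised-pair Muu₂ (u≢u₂ ∘ sym) i j ij≡uu₂
  ...   | Mij , r≡ , _ rewrite Mij | r≡ with i <ᶠ j
  ...     | false = z≤n
  ...     | true  = ≤-trans (≤-reflexive (+-identityʳ lost₂)) (≤-trans (m≤n+m lost₂ 1) (≤-reflexive (cong suc (sym (+-identityʳ lost₂)))))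
  old-old-step i j | false | true with raised-pair Muu₁ (u≢u₁ ∘ sym) i j ij≡uu₁
  ...   | Mij , r≡ , d≡ rewrite Mij | r≡ | d≡ with i <ᶠ j
  ...     | false = z≤n
  ...     | true  = begin
    w⁺ (suc (d u + d u₁)) + (gain₁ + 0)   ≡⟨ cong (w⁺ (suc (d u + d u₁)) +_) (+-identityʳ gain₁) ⟩
    w⁺ (suc (d u + d u₁)) + gain₁         ≤⟨ m+[n∸m]≤1+n (⌈/√⌉≤1+⌊/√⌋ N (≤-trans (deg-pos M Muu₁) (m≤m+n _ _)) (n≤1+n _)) ⟩
    suc (w⁻ (d u + d u₁))                 ≡⟨ +-comm 1 _ ⟩
    w⁻ (d u + d u₁) + (1 + 0)             ∎
    where open ≤-Reasoning
  old-old-step i j | false | false with M i j ∧ i <ᶠ j in ij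
  ...   | false = z≤n
  ...   | true  = begin
    w⁺ (raised i + raised j) + 0   ≡⟨ +-identityʳ _ ⟩
    w⁺ (raised i + raised j)       ≤⟨ ⌈/√⌉≤1+⌊/√⌋ N (≤-trans (deg-pos M (proj₁ (∧-true ij))) (m≤m+n _ _))
                                                    (+-mono-≤ (m≤m+n (d i) _) (m≤m+n (d j) _)) ⟩
    suc (w⁻ (d i + d j))           ≡⟨ +-comm 1 _ ⟩
    w⁻ (d i + d j) + (1 + 0)       ∎
    where open ≤-Reasoning

  old-old-block : ∑∑ (λ i j → edgeTerm H w⁺ (old i) (old j)) + gain₁
                ≤ ∑∑ (λ i j → edgeTerm H' w⁻ (old i) (old j)) + (‖ M ‖ + lost₂)
  old-old-block = begin
    ∑∑ (λ i j → edgeTerm H w⁺ (old i) (old j)) + gain₁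
      ≡⟨ cong₂ _+_ (∑∑-cong (λ i j → edgeTerm H w⁺ (old i) (old j)) termH termH≡) (sym (∑∑-samePair u≢u₁ gain₁)) ⟩
    ∑∑ termH + ∑∑ gainAt
      ≡⟨ ∑∑-distrib-+ termH gainAt ⟨
    ∑∑ (λ i j → termH i j + gainAt i j)
      ≤⟨ ∑∑-mono-≤ (λ i j → termH i j + gainAt i j) (λ i j → termH' i j + (𝟙 (M i j ∧ i <ᶠ j) + lostAt i j)) old-old-step ⟩
    ∑∑ (λ i j → termH' i j + (𝟙 (M i j ∧ i <ᶠ j) + lostAt i j))
      ≡⟨ ∑∑-distrib-+ termH' (λ i j → 𝟙 (M i j ∧ i <ᶠ j) + lostAt i j) ⟩
    ∑∑ termH' + ∑∑ (λ i j → 𝟙 (M i j ∧ i <ᶠ j) + lostAt i j)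
      ≡⟨ cong (∑∑ termH' +_) (∑∑-distrib-+ (λ i j → 𝟙 (M i j ∧ i <ᶠ j)) lostAt) ⟩
    ∑∑ termH' + (‖ M ‖ + ∑∑ lostAt)
      ≡⟨ cong₂ _+_ (sym (∑∑-cong (λ i j → edgeTerm H' w⁻ (old i) (old j)) termH' termH'≡)) (cong (‖ M ‖ +_) (∑∑-samePair u≢u₂ lost₂)) ⟩
    ∑∑ (λ i j → edgeTerm H' w⁻ (old i) (old j)) + (‖ M ‖ + lost₂) ∎
    where
    open ≤-Reasoning
    termH termH' gainAt lostAt : Fin n → Fin n → ℕ
    termH  i j = if M i j ∧ i <ᶠ j then w⁺ (raised i + raised j) else 0
    termH' i j = if (if samePair i j u u₂ then false else M i j) ∧ i <ᶠ j then w⁻ (d i + d j) else 0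
    gainAt i j = 𝟙 (samePair i j u u₁ ∧ i <ᶠ j) * gain₁
    lostAt i j = 𝟙 (samePair i j u u₂ ∧ i <ᶠ j) * lost₂
    old<ᵇold : ∀ i j → (toℕ (old i) <ᵇ toℕ (old j)) ≡ i <ᶠ j
    old<ᵇold i j = cong₂ _<ᵇ_ (Finₚ.toℕ-↑ˡ i (suc b)) (Finₚ.toℕ-↑ˡ j (suc b))
    termH≡ : ∀ i j → edgeTerm H w⁺ (old i) (old j) ≡ termH i j
    termH≡ i j = cong₂ (λ c x → if c then x else 0) (cong₂ _∧_ (H-old-old i j) (old<ᵇold i j))
                       (cong w⁺ (cong₂ _+_ (deg-H-old i) (deg-H-old j)))
    termH'≡ : ∀ i j → edgeTerm H' w⁻ (old i) (old j) ≡ termH' i j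
    termH'≡ i j = cong₂ (λ c x → if c then x else 0) (cong₂ _∧_ (H'-old-old i j) (old<ᵇold i j))
                        (cong w⁻ (cong₂ _+_ (deg-H'-old i) (deg-H'-old j)))

  β : ℕ
  β = 𝟙 (0 <ᵇ b)

  private
    old<ᵇnew : ∀ i k → (toℕ (old i) <ᵇ toℕ (new k)) ≡ true
    old<ᵇnew i k = <ᵇ-true (old<new i k)

    anchorEdge≡ : ∀ i k → anchorEdge i k ≡ true → i ≡ u × k ≡ fzero
    anchorEdge≡ i fzero    ik = ≟-true (proj₁ (∧-true ik)) , refl
    anchorEdge≡ i (fsuc k) ik with () ← trans (sym (∧-zeroʳ ⌊ i ≟ u ⌋)) ik

    ∑∑-anchorEdge : ∀ (v : Fin n → Fin (suc b) → ℕ) → ∑∑ (λ i k → if anchorEdge i k then v i k else 0) ≡ v u fzero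
    ∑∑-anchorEdge v = trans (∑∑-supportedAt (λ i k → if anchorEdge i k then v i k else 0) u fzero
      (λ i k i≢u → cong (λ c → if c ∧ (toℕ k ≡ᵇ 0) then v i k else 0) (≟-≢ i≢u))
      λ where fzero    0≢0 → ⊥-elim (0≢0 refl)
              (fsuc k) _   → cong (λ c → if c then v u (fsuc k) else 0) (∧-zeroʳ ⌊ u ≟ u ⌋))
      (cong (λ c → if c ∧ true then v u fzero else 0) (≟-≡ {x = u} refl))

  old-new-H : ∑∑ (λ i k → edgeTerm H w⁺ (old i) (new k)) ≡ w⁺ (d u + 1 + suc β)
  old-new-H = begin
    ∑∑ (λ i k → edgeTerm H w⁺ (old i) (new k))
      ≡⟨ ∑∑-cong _ termH termH≡ ⟩
    ∑∑ termH
      ≡⟨ ∑∑-anchorEdge (λ i k → w⁺ (raised i + suc (𝟙 (toℕ k <ᵇ b)))) ⟩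
    w⁺ (raised u + suc β)
      ≡⟨ cong (λ c → w⁺ (d u + 𝟙 c + suc β)) (≟-≡ {x = u} refl) ⟩
    w⁺ (d u + 1 + suc β) ∎
    where
    open ≡-Reasoning
    termH : Fin n → Fin (suc b) → ℕ
    termH i k = if anchorEdge i k then w⁺ (raised i + suc (𝟙 (toℕ k <ᵇ b))) else 0
    termH≡ : ∀ i k → edgeTerm H w⁺ (old i) (new k) ≡ termH i k
    termH≡ i k = cong₂ (λ c x → if c then x else 0)
                   (trans (cong₂ _∧_ (H-old-new i k) (old<ᵇnew i k)) (∧-identityʳ (anchorEdge i k)))
                   (cong w⁺ (cong₂ _+_ (deg-H-old i) (deg-H-new k)))

  old-new-H' : w⁻ (d u + 2) + w⁻ (d u₂ + 2) ≤ ∑∑ (λ i k → edgeTerm H' w⁻ (old i) (new k))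
  old-new-H' = begin
    w⁻ (d u + 2) + w⁻ (d u₂ + 2)
      ≡⟨ cong₂ _+_ (∑∑-anchorEdge (λ i k → w⁻ (d i + 2)))
                   (∑∑-supportedAt atEnd u₂ last off-end₁ off-end₂ ⟨ trans ⟩
                    cong₂ (λ c c' → if c ∧ c' then w⁻ (d u₂ + 2) else 0) (≟-≡ {x = u₂} refl) (≟-≡ {x = last} refl)) ⟨
    ∑∑ atAnchor + ∑∑ atEnd
      ≡⟨ ∑∑-distrib-+ atAnchor atEnd ⟨
    ∑∑ (λ i k → atAnchor i k + atEnd i k)
      ≤⟨ ∑∑-mono-≤ (λ i k → atAnchor i k + atEnd i k) termH' both ⟩
    ∑∑ termH'
      ≡⟨ ∑∑-cong _ termH' termH'≡ ⟨
    ∑∑ (λ i k → edgeTerm H' w⁻ (old i) (new k)) ∎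
    where
    open ≤-Reasoning
    end : Fin n → Fin (suc b) → Bool
    end i k = ⌊ i ≟ u₂ ⌋ ∧ ⌊ k ≟ last ⌋
    atAnchor atEnd termH' : Fin n → Fin (suc b) → ℕ
    atAnchor  i k = if anchorEdge i k then w⁻ (d i + 2) else 0
    atEnd  i k = if end i k then w⁻ (d i + 2) else 0
    termH' i k = if (if end i k then true else anchorEdge i k) then w⁻ (d i + 2) else 0
    termH'≡ : ∀ i k → edgeTerm H' w⁻ (old i) (new k) ≡ termH' i k
    termH'≡ i k = cong₂ (λ c x → if c then x else 0)
                    (trans (cong₂ _∧_ (H'-old-new i k) (old<ᵇnew i k)) (∧-identityʳ _))
                    (cong w⁻ (cong₂ _+_ (deg-H'-old i) (deg-H'-new k)))
    off-end₁ : ∀ i k → i ≢ u₂ → atEnd i k ≡ 0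
    off-end₁ i k i≢u₂ = cong (λ c → if c ∧ ⌊ k ≟ last ⌋ then w⁻ (d i + 2) else 0) (≟-≢ i≢u₂)
    off-end₂ : ∀ k → k ≢ last → atEnd u₂ k ≡ 0
    off-end₂ k k≢last = cong (λ c → if c then w⁻ (d u₂ + 2) else 0)
                          (trans (cong (⌊ u₂ ≟ u₂ ⌋ ∧_) (≟-≢ k≢last)) (∧-zeroʳ _))
    both : ∀ i k → atAnchor i k + atEnd i k ≤ termH' i k
    both i k with end i k in e | anchorEdge i k in h
    ... | true  | true  = ⊥-elim (u≢u₂ (trans (sym (proj₁ (anchorEdge≡ i k h))) (≟-true (proj₁ (∧-true e)))))
    ... | true  | false = ≤-refl
    ... | false | true  = ≤-reflexive (+-identityʳ _)
    ... | false | false = z≤n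

  new-old-H : ∑∑ (λ k i → edgeTerm H w⁺ (new k) (old i)) ≡ 0
  new-old-H = ∑∑-zero _ λ k i → cong (λ c → if c then w⁺ (deg H (new k) + deg H (old i)) else 0)
    (trans (cong (H (new k) (old i) ∧_) (<ᵇ-false (<⇒≯ (old<new i k)))) (∧-zeroʳ _))

  new-new-block : w⁺ 4 ≤ w⁻ 4 →
    ∑∑ (λ k l → edgeTerm H w⁺ (new k) (new l)) ≤ ∑∑ (λ k l → edgeTerm H' w⁻ (new k) (new l)) + β * (w⁺ 3 ∸ w⁻ 4)
  new-new-block w⁺4≤w⁻4 = begin
    ∑∑ (λ k l → edgeTerm H w⁺ (new k) (new l))
      ≡⟨ ∑∑-cong (λ k l → edgeTerm H w⁺ (new k) (new l)) termH termH≡ ⟩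
    ∑∑ termH
      ≤⟨ ∑∑-mono-≤ termH (λ k l → termH' k l + intoLast k l) pointwise ⟩
    ∑∑ (λ k l → termH' k l + intoLast k l)
      ≡⟨ ∑∑-distrib-+ termH' intoLast ⟩
    ∑∑ termH' + ∑∑ intoLast
      ≡⟨ cong₂ _+_ (sym (∑∑-cong (λ k l → edgeTerm H' w⁻ (new k) (new l)) termH' termH'≡)) (∑∑-pathEdge-into-last b (w⁺ 3 ∸ w⁻ 4)) ⟩
    ∑∑ (λ k l → edgeTerm H' w⁻ (new k) (new l)) + β * (w⁺ 3 ∸ w⁻ 4) ∎
    where
    open ≤-Reasoning
    termH termH' intoLast : Fin (suc b) → Fin (suc b) → ℕ
    termH    k l = if pathEdge k l then w⁺ (suc (𝟙 (toℕ k <ᵇ b)) + suc (𝟙 (toℕ l <ᵇ b))) else 0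
    termH'   k l = if pathEdge k l then w⁻ 4 else 0
    intoLast k l = if pathEdge k l ∧ ⌊ l ≟ last ⌋ then w⁺ 3 ∸ w⁻ 4 else 0
    new<ᵇnew : ∀ k l → (toℕ (new k) <ᵇ toℕ (new l)) ≡ k <ᶠ l
    new<ᵇnew k l = trans (cong₂ _<ᵇ_ (Finₚ.toℕ-↑ʳ n k) (Finₚ.toℕ-↑ʳ n l)) (+-<ᵇ n (toℕ k) (toℕ l))
    termH≡ : ∀ k l → edgeTerm H w⁺ (new k) (new l) ≡ termH k l
    termH≡ k l = cong₂ (λ c x → if c then x else 0) (cong₂ _∧_ (H-new-new k l) (new<ᵇnew k l))
                       (cong w⁺ (cong₂ _+_ (deg-H-new k) (deg-H-new l)))
    termH'≡ : ∀ k l → edgeTerm H' w⁻ (new k) (new l) ≡ termH' k l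
    termH'≡ k l = cong₂ (λ c x → if c then x else 0) (cong₂ _∧_ (H'-new-new k l) (new<ᵇnew k l))
                        (cong w⁻ (cong₂ _+_ (deg-H'-new k) (deg-H'-new l)))
    into-last : ∀ {x y} → x < b → ¬ y < b → w⁺ (suc (𝟙 (x <ᵇ b)) + suc (𝟙 (y <ᵇ b))) ≤ w⁻ 4 + (w⁺ 3 ∸ w⁻ 4)
    into-last x<b y≮b rewrite <ᵇ-true x<b | <ᵇ-false y≮b = m≤n+m∸n (w⁺ 3) (w⁻ 4)
    inner : ∀ {x y} → x < b → y < b → w⁺ (suc (𝟙 (x <ᵇ b)) + suc (𝟙 (y <ᵇ b))) ≤ w⁻ 4 + 0
    inner x<b y<b rewrite <ᵇ-true x<b | <ᵇ-true y<b = ≤-trans w⁺4≤w⁻4 (m≤m+n (w⁻ 4) 0)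
    pointwise : ∀ k l → termH k l ≤ termH' k l + intoLast k l
    pointwise k l with pathEdge k l in kl | ⌊ l ≟ last ⌋ in l≟last
    ... | false | _     = z≤n
    ... | true  | true  = into-last (≤-reflexive (trans (pathEdge-suc k l kl) l≡b)) (<-irrefl l≡b)
      where
      l≡b : toℕ l ≡ b
      l≡b = trans (cong toℕ (≟-true l≟last)) (Finₚ.toℕ-fromℕ b)
    ... | true  | false = inner (<-trans (≤-reflexive (pathEdge-suc k l kl)) l<b) l<b
      where
      l<b : toℕ l < b
      l<b = ≤∧≢⇒< (s≤s⁻¹ (Finₚ.toℕ<n l))
              (≟-false l≟last ∘ Finₚ.toℕ-injective ∘ λ l≡b → trans l≡b (sym (Finₚ.toℕ-fromℕ b)))

  accounting : w⁺ 4 ≤ w⁻ 4 →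
    ∑ᴱ H w⁺ + gain N (d u) (d u₁) (d u₂) ≤ ∑ᴱ H' w⁻ + (‖ M ‖ + spend N (d u) (d u₂) β)
  accounting w⁺4≤w⁻4 = begin
    ∑ᴱ H w⁺ + (gain₁ + g₂)
      ≡⟨ cong (_+ (gain₁ + g₂)) (trans (∑ᴱ≡∑∑ H w⁺) (∑∑-↑ n (suc b) (edgeTerm H w⁺))) ⟩
    ((A₁ + A₂) + (A₃ + A₄)) + (gain₁ + g₂)
      ≡⟨ cong₂ (λ x y → ((A₁ + x) + (y + A₄)) + (gain₁ + g₂)) old-new-H new-old-H ⟩
    ((A₁ + m) + (0 + A₄)) + (gain₁ + g₂)
      ≡⟨ regroup A₁ m A₄ gain₁ g₂ ⟩
    (A₁ + gain₁) + (g₂ + (A₄ + m))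
      ≤⟨ +-mono-≤ old-old-block (+-mono-≤ old-new-H' (+-monoˡ-≤ m (new-new-block w⁺4≤w⁻4))) ⟩
    (B₁ + (‖ M ‖ + lost₂)) + (B₂ + ((B₄ + z) + m))
      ≡⟨ regroup′ B₁ B₂ B₄ ‖ M ‖ lost₂ m z ⟩
    ((B₁ + B₂) + (0 + B₄)) + (‖ M ‖ + ((lost₂ + m) + z))
      ≤⟨ +-monoˡ-≤ _ (+-monoʳ-≤ (B₁ + B₂) (+-monoˡ-≤ B₄ (z≤n {B₃}))) ⟩
    ((B₁ + B₂) + (B₃ + B₄)) + (‖ M ‖ + ((lost₂ + m) + z))
      ≡⟨ cong (_+ (‖ M ‖ + ((lost₂ + m) + z))) (trans (∑ᴱ≡∑∑ H' w⁻) (∑∑-↑ n (suc b) (edgeTerm H' w⁻))) ⟨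
    ∑ᴱ H' w⁻ + (‖ M ‖ + ((lost₂ + m) + z)) ∎
    where
    open ≤-Reasoning
    A₁ A₂ A₃ A₄ B₁ B₂ B₃ B₄ g₂ m z : ℕ
    A₁ = ∑∑ (λ i j → edgeTerm H w⁺ (old i) (old j))
    A₂ = ∑∑ (λ i k → edgeTerm H w⁺ (old i) (new k))
    A₃ = ∑∑ (λ k i → edgeTerm H w⁺ (new k) (old i))
    A₄ = ∑∑ (λ k l → edgeTerm H w⁺ (new k) (new l))
    B₁ = ∑∑ (λ i j → edgeTerm H' w⁻ (old i) (old j))
    B₂ = ∑∑ (λ i k → edgeTerm H' w⁻ (old i) (new k))
    B₃ = ∑∑ (λ k i → edgeTerm H' w⁻ (new k) (old i))
    B₄ = ∑∑ (λ k l → edgeTerm H' w⁻ (new k) (new l))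
    g₂ = w⁻ (d u + 2) + w⁻ (d u₂ + 2)
    m  = w⁺ (d u + 1 + suc β)
    z  = β * (w⁺ 3 ∸ w⁻ 4)
    regroup : ∀ a₁ m a₄ g₁ g₂ → ((a₁ + m) + (0 + a₄)) + (g₁ + g₂) ≡ (a₁ + g₁) + (g₂ + (a₄ + m))
    regroup = solve-∀
    regroup′ : ∀ b₁ b₂ b₄ e l m z → (b₁ + (e + l)) + (b₂ + ((b₄ + z) + m)) ≡ ((b₁ + b₂) + (0 + b₄)) + (e + ((l + m) + z))
    regroup′ = solve-∀

spend-scale : ∀ Q K du d₂ β → spend (Q * K) du d₂ β ≤ spend Q du d₂ β * K
spend-scale Q K du d₂ β = begin
  ⌈ Q * K /√ suc (du + d₂) ⌉ + ⌈ Q * K /√ (du + 1 + suc β) ⌉ + β * (⌈ Q * K /√ 3 ⌉ ∸ ⌊ Q * K /√ 4 ⌋)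
    ≤⟨ +-mono-≤ (+-mono-≤ (⌈/√⌉-scale Q K (suc (du + d₂)) (s≤s z≤n)) (⌈/√⌉-scale Q K (du + 1 + suc β) (≤-trans (s≤s z≤n) (m≤n+m (suc β) (du + 1)))))
                (*-monoʳ-≤ β (∸-mono (⌈/√⌉-scale Q K 3 (s≤s z≤n)) (⌊/√⌋-scale Q K 4 (s≤s z≤n)))) ⟩
  ⌈ Q /√ suc (du + d₂) ⌉ * K + ⌈ Q /√ (du + 1 + suc β) ⌉ * K + β * (⌈ Q /√ 3 ⌉ * K ∸ ⌊ Q /√ 4 ⌋ * K)
    ≡⟨ cong (λ x → ⌈ Q /√ suc (du + d₂) ⌉ * K + ⌈ Q /√ (du + 1 + suc β) ⌉ * K + β * x) (*-distribʳ-∸ K ⌈ Q /√ 3 ⌉ ⌊ Q /√ 4 ⌋) ⟨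
  ⌈ Q /√ suc (du + d₂) ⌉ * K + ⌈ Q /√ (du + 1 + suc β) ⌉ * K + β * ((⌈ Q /√ 3 ⌉ ∸ ⌊ Q /√ 4 ⌋) * K)
    ≡⟨ factor ⌈ Q /√ suc (du + d₂) ⌉ ⌈ Q /√ (du + 1 + suc β) ⌉ (⌈ Q /√ 3 ⌉ ∸ ⌊ Q /√ 4 ⌋) β K ⟩
  spend Q du d₂ β * K ∎
  where
  open ≤-Reasoning
  factor : ∀ a b c β K → a * K + b * K + β * (c * K) ≡ (a + b + β * c) * K
  factor = solve-∀

gain-scale : ∀ Q K {du} d₁ d₂ → 1 ≤ du → gain Q du d₁ d₂ * K ≤ gain (Q * K) du d₁ d₂
gain-scale Q K {du} d₁ d₂ 1≤du = begin
  gain Q du d₁ d₂ * K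
    ≡⟨ factor (⌊ Q /√ (du + d₁) ⌋ ∸ ⌈ Q /√ suc (du + d₁) ⌉) ⌊ Q /√ (du + 2) ⌋ ⌊ Q /√ (d₂ + 2) ⌋ K ⟩
  (⌊ Q /√ (du + d₁) ⌋ ∸ ⌈ Q /√ suc (du + d₁) ⌉) * K + (⌊ Q /√ (du + 2) ⌋ * K + ⌊ Q /√ (d₂ + 2) ⌋ * K)
    ≡⟨ cong (_+ (⌊ Q /√ (du + 2) ⌋ * K + ⌊ Q /√ (d₂ + 2) ⌋ * K)) (*-distribʳ-∸ K ⌊ Q /√ (du + d₁) ⌋ ⌈ Q /√ suc (du + d₁) ⌉) ⟩
  (⌊ Q /√ (du + d₁) ⌋ * K ∸ ⌈ Q /√ suc (du + d₁) ⌉ * K) + (⌊ Q /√ (du + 2) ⌋ * K + ⌊ Q /√ (d₂ + 2) ⌋ * K)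
    ≤⟨ +-mono-≤ (∸-mono (⌊/√⌋-scale Q K (du + d₁) 1≤du+d₁) (⌈/√⌉-scale Q K (suc (du + d₁)) (s≤s z≤n)))
                (+-mono-≤ (⌊/√⌋-scale Q K (du + 2) (≤-trans 1≤du (m≤m+n du 2))) (⌊/√⌋-scale Q K (d₂ + 2) (≤-trans (s≤s z≤n) (m≤n+m 2 d₂)))) ⟩
  gain (Q * K) du d₁ d₂ ∎
  where
  open ≤-Reasoning
  1≤du+d₁ : 1 ≤ du + d₁
  1≤du+d₁ = ≤-trans 1≤du (m≤m+n du d₁)
  factor : ∀ a b c K → (a + (b + c)) * K ≡ a * K + (b * K + c * K)
  factor = solve-∀

-- ‖ M ‖ < K absorbs the rounding error of at most one unit per edge of M
budget : ∀ {X Y E K g s ĝ ŝ} → X + g ≤ Y + (E + s) → E < K → s ≤ ŝ * K → ĝ * K ≤ g → ŝ < ĝ → X < Y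
budget {X} {Y} {E} {K} {g} {s} {ĝ} {ŝ} accounts E<K s≤ŝK ĝK≤g ŝ<ĝ = +-cancelʳ-< g X Y (begin-strict
  X + g          ≤⟨ accounts ⟩
  Y + (E + s)    <⟨ +-monoʳ-< Y (+-mono-<-≤ E<K s≤ŝK) ⟩
  Y + (K + ŝ * K) ≤⟨ +-monoʳ-≤ Y (≤-trans (*-monoˡ-≤ K ŝ<ĝ) ĝK≤g) ⟩
  Y + g          ∎)
  where open ≤-Reasoning

opaque
  unfolding ⌊_/√_⌋

  case-I-table : ∀ p (i j : Fin 5) → suc (spend 1000 2 (suc (toℕ j)) (𝟙 p)) ≤ gain 1000 2 (suc (toℕ i)) (suc (toℕ j))
  case-I-table false = toWitness {a? = Finₚ.all? λ i → Finₚ.all? λ j →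
    suc (spend 1000 2 (suc (toℕ j)) 0) ≤? gain 1000 2 (suc (toℕ i)) (suc (toℕ j))} _
  case-I-table true  = toWitness {a? = Finₚ.all? λ i → Finₚ.all? λ j →
    suc (spend 1000 2 (suc (toℕ j)) 1) ≤? gain 1000 2 (suc (toℕ i)) (suc (toℕ j))} _

  case-II-table : ∀ p → suc (spend 1000 3 2 (𝟙 p)) ≤ ⌊ 1000 /√ 5 ⌋ + ⌊ 1000 /√ 4 ⌋
  case-II-table false = toWitness {a? = suc (spend 1000 3 2 0) ≤? ⌊ 1000 /√ 5 ⌋ + ⌊ 1000 /√ 4 ⌋} _
  case-II-table true  = toWitness {a? = suc (spend 1000 3 2 1) ≤? ⌊ 1000 /√ 5 ⌋ + ⌊ 1000 /√ 4 ⌋} _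

  case-III-table : ∀ p → suc (spend 1000 4 2 (𝟙 p)) ≤ ⌊ 1000 /√ 6 ⌋ + ⌊ 1000 /√ 4 ⌋
  case-III-table false = toWitness {a? = suc (spend 1000 4 2 0) ≤? ⌊ 1000 /√ 6 ⌋ + ⌊ 1000 /√ 4 ⌋} _
  case-III-table true  = toWitness {a? = suc (spend 1000 4 2 1) ≤? ⌊ 1000 /√ 6 ⌋ + ⌊ 1000 /√ 4 ⌋} _

  1000/√4-exact : ⌊ 1000 /√ 4 ⌋ ≡ ⌈ 1000 /√ 4 ⌉
  1000/√4-exact = refl

case-I-table! : ∀ p {d₁ d₂} → 1 ≤ d₁ → d₁ ≤ 5 → 1 ≤ d₂ → d₂ ≤ 5 → suc (spend 1000 2 d₂ (𝟙 p)) ≤ gain 1000 2 d₁ d₂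
case-I-table! p {suc d₁} {suc d₂} _ d₁<5 _ d₂<5 =
  subst₂ (λ x y → suc (spend 1000 2 y (𝟙 p)) ≤ gain 1000 2 x y) (index d₁<5) (index d₂<5)
         (case-I-table p (fromℕ< d₁<5) (fromℕ< d₂<5))
  where
  index : ∀ {x} (x<5 : x < 5) → suc (toℕ (fromℕ< x<5)) ≡ suc x
  index x<5 = cong suc (Finₚ.toℕ-fromℕ< x<5)

case-II-table! : ∀ p d₁ → suc (spend 1000 3 2 (𝟙 p)) ≤ gain 1000 3 d₁ 2
case-II-table! p d₁ = ≤-trans (case-II-table p) (m≤n+m _ (⌊ 1000 /√ (3 + d₁) ⌋ ∸ ⌈ 1000 /√ suc (3 + d₁) ⌉))

case-III-table! : ∀ p d₁ → suc (spend 1000 4 2 (𝟙 p)) ≤ gain 1000 4 d₁ 2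
case-III-table! p d₁ = ≤-trans (case-III-table p) (m≤n+m _ (⌊ 1000 /√ (4 + d₁) ⌋ ∸ ⌈ 1000 /√ suc (4 + d₁) ⌉))

module Comparison {n} (M : AdjFn n) (M-sym : ∀ i j → M i j ≡ M j i)
                  {u u₁ u₂ : Fin n} (u≢u₁ : u ≢ u₁) (u≢u₂ : u ≢ u₂) (u₁≢u₂ : u₁ ≢ u₂)
                  (Muu₁ : M u u₁ ≡ true) (Muu₂ : M u u₂ ≡ true) (b : ℕ)
                  (K : ℕ) .{{_ : NonZero K}} (‖M‖<K : ‖ M ‖ < K) where

  open Accounting M M-sym u≢u₁ u≢u₂ u₁≢u₂ Muu₁ Muu₂ b (1000 * K) public

  χ-<-from-margin : suc (spend 1000 (d u) (d u₂) β) ≤ gain 1000 (d u) (d u₁) (d u₂) → χ-< H H'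
  χ-<-from-margin margin = χ-<-by-approximation H H' (1000 * K) {{m*n≢0 1000 K}}
    (budget (accounting w⁺4≤w⁻4) ‖M‖<K (spend-scale 1000 K (d u) (d u₂) β)
            (gain-scale 1000 K (d u₁) (d u₂) (deg-pos M Muu₁)) margin)
    where
    w⁺4≤w⁻4 : w⁺ 4 ≤ w⁻ 4
    w⁺4≤w⁻4 = ≤-trans (⌈/√⌉-scale 1000 K 4 (s≤s z≤n))
                (subst (λ c → c * K ≤ w⁻ 4) 1000/√4-exact (⌊/√⌋-scale 1000 K 4 (s≤s z≤n)))

lemma12 : (n b : ℕ) (M : AdjFn n) → IsSimple M → Connected M →
          (u u₁ u₂ : Fin n) → 2 ≤ deg M u → deg M u ≤ 4 →
          M u u₁ ≡ true → M u u₂ ≡ true → u₁ ≢ u₂ →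
          let H  = attachPath M u b
              H' = moveEdge H (u ↑ˡ _) (u₂ ↑ˡ _) (pendent n b) (u₂ ↑ˡ _)
          in ((deg M u ≡ 2 → ((v : Fin n) → deg M v ≤ 5) → χ-< H H')
             × (deg M u ≡ 3 →
                Σ (Fin n) (λ v → Σ (Fin n) (λ w → v ≢ w × M u v ≡ true × M u w ≡ true
                                                  × deg M v ≡ 2 × deg M w ≡ 2)) →
                deg M u₂ ≡ 2 → χ-< H H')
             × (deg M u ≡ 4 → ((v : Fin n) → M u v ≡ true → deg M v ≡ 2) → χ-< H H'))
lemma12 n b M (M-sym , loopless) _ u u₁ u₂ _ _ Muu₁ Muu₂ u₁≢u₂ =
    (λ du≡2 Δ≤5 → χ-<-when du≡2 refl (case-I-table! (0 <ᵇ b) (deg-pos M Mu₁u) (Δ≤5 u₁) (deg-pos M Mu₂u) (Δ≤5 u₂)))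
  , (λ du≡3 _ d₂≡2 → χ-<-when du≡3 d₂≡2 (case-II-table! (0 <ᵇ b) (deg M u₁)))
  , (λ du≡4 nbrs≡2 → χ-<-when du≡4 (nbrs≡2 u₂ Muu₂) (case-III-table! (0 <ᵇ b) (deg M u₁)))
  where
  adjacent⇒≢ : ∀ {x y} → M x y ≡ true → x ≢ y
  adjacent⇒≢ {x} Mxy refl with () ← trans (sym Mxy) (loopless x)
  Mu₁u : M u₁ u ≡ true
  Mu₁u = trans (M-sym u₁ u) Muu₁
  Mu₂u : M u₂ u ≡ true
  Mu₂u = trans (M-sym u₂ u) Muu₂
  open Comparison M M-sym (adjacent⇒≢ Muu₁) (adjacent⇒≢ Muu₂) u₁≢u₂ Muu₁ Muu₂ b (suc (n * n)) (s≤s (‖‖≤n² M))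
  χ-<-when : ∀ {x y} → deg M u ≡ x → deg M u₂ ≡ y → suc (spend 1000 x y β) ≤ gain 1000 x (deg M u₁) y → χ-< H H'
  χ-<-when refl refl = χ-<-from-margin
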